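{- Let $\epsilon\in(0,0.5)$ be a constant and let $\ell\ge k$ with $2^\ell\in\mathbb{N}$ and $k\le\ell-2+\log_2(0.5-\epsilon)$. Suppose $\mathtt{nmE}:[2^\ell]\times[2^\ell]\to\{0,1\}$ is quasi-orthogonal with error $\epsilon$ and is a non-malleable two-source $(k,\epsilon)$-extractor. Let $G=(V_1\cup V_0,E)$ be the $2^{\ell+1}$-vertex graph with $V_\sigma=\{\langle\sigma,i\rangle:i\in[2^\ell]\}$ and $E=\{\{\langle1,i\rangle,\langle0,j\rangle\}:\mathtt{nmE}(i,j)=1\}\cup\binom{V_1}{2}$. Then $G$ is $\Omega(|V_1\cup V_0|)$-robustly self-ordered, i.e., $c\cdot 2^{\ell+1}$-robustly self-ordered for a constant $c>0$ depending only on $\epsilon$. Furthermore, the same conclusion holds even if the non-malleability condition of $\mathtt{nmE}$ is only assumed for permutations $f,g$.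
   Context: A random variable over $[2^\ell]$ is an $(\ell,k)$-source if each value has probability at most $2^{ -k}$. $\mathtt{nmE}:[2^\ell]\times[2^\ell]\to\{0,1\}$ is a non-malleable two-source $(k,\epsilon)$-extractor if for every two independent $(\ell,k)$-sources $X,Y$ and every $f,g:[2^\ell]\to[2^\ell]$ without fixed points, $\frac12\sum_{\alpha,\beta\in\{0,1\}}\big|\Pr[(\mathtt{nmE}(X,Y),\mathtt{nmE}(f(X),g(Y)))=(\alpha,\beta)]-\frac12\Pr[\mathtt{nmE}(f(X),g(Y))=\beta]\big|\le\epsilon$. $\mathtt{nmE}$ is quasi-orthogonal with error $\epsilon$ if (1) for every $x$ and $\sigma\in\{0,1\}$, $|\{y:\mathtt{nmE}(x,y)=\sigma\}|\le(0.5+\epsilon)2^\ell$, and symmetrically for every fixed $y$; and (2) for every $x\ne x'$, $|\{y:\mathtt{nmE}(x,y)\ne\mathtt{nmE}(x',y)\}|\ge(0.5-\epsilon)2^\ell$, and symmetrically for every $y\ne y'$. A graph $G=(V,E)$ is $\rho$-robustly self-ordered if for every permutation $\pi$ of $V$, $|E\triangle\{\{\pi(u),\pi(v)\}:\{u,v\}\in E\}|\ge\rho|\{v:\pi(v)\ne v\}|$.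
   Formalization: The constant ε is rational and k is restricted to values with 2ᵏ rational, while the probabilities of the (ℓ,k)-sources in the extractor condition take values in the rationals. -}

module Defs where

open import Data.Bool using (Bool; true; false; if_then_else_; _xor_; not)
open import Data.Nat using (ℕ; zero; suc)
open import Data.Integer using (+_)
open import Data.Fin using (Fin)
import Data.Fin as F
open import Data.Product using (_×_; _,_; Σ)
open import Data.Rational using (ℚ; 0ℚ; 1ℚ; ½; _+_; _*_; _-_; _/_; ∣_∣; _≤_; _<_)
open import Function using (_∘_; _↔_; Inverse)
open import Relation.Binary.PropositionalEquality using (_≡_; _≢_)
open import Relation.Nullary using (does)

toℚ : ℕ → ℚ
toℚ n = + n / 1

Σℚ : (n : ℕ) → (Fin n → ℚ) → ℚ
Σℚ zero    f = 0ℚ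
Σℚ (suc n) f = f F.zero + Σℚ n (f ∘ F.suc)

ΣB : (Bool → ℚ) → ℚ
ΣB f = f true + f false

𝟙 : Bool → ℚ
𝟙 b = if b then 1ℚ else 0ℚ

count : (n : ℕ) → (Fin n → Bool) → ℚ
count n P = Σℚ n (λ i → 𝟙 (P i))

_==B_ : Bool → Bool → Bool
a ==B b = not (a xor b)

_==F_ : {n : ℕ} → Fin n → Fin n → Bool
i ==F j = does (i F.≟ j)

-- Sources.  [N] = Fin N (N = 2^ℓ).  A random variable over [N] is a
-- probability vector p : Fin N → ℚ.  K stands for 2^k, so an (ℓ,k)-source
-- is one with p i ≤ 2^{-k}, written p i * K ≤ 1.

IsDistribution : (N : ℕ) → (Fin N → ℚ) → Set
IsDistribution N p = (∀ i → 0ℚ ≤ p i) × Σℚ N p ≡ 1ℚ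

IsSource : (N : ℕ) (K : ℚ) → (Fin N → ℚ) → Set
IsSource N K p = IsDistribution N p × (∀ i → p i * K ≤ 1ℚ)

NoFixedPoints : {N : ℕ} → (Fin N → Fin N) → Set
NoFixedPoints f = ∀ x → f x ≢ x

PrJoint : (N : ℕ) → (Fin N → Fin N → Bool) → (p q : Fin N → ℚ) →
          (f g : Fin N → Fin N) → Bool → Bool → ℚ
PrJoint N nmE p q f g α β =
  Σℚ N (λ x → Σℚ N (λ y →
    p x * q y * 𝟙 ((nmE x y ==B α) Data.Bool.∧ (nmE (f x) (g y) ==B β))))

PrTampered : (N : ℕ) → (Fin N → Fin N → Bool) → (p q : Fin N → ℚ) →
             (f g : Fin N → Fin N) → Bool → ℚ
PrTampered N nmE p q f g β =
  Σℚ N (λ x → Σℚ N (λ y → p x * q y * 𝟙 (nmE (f x) (g y) ==B β)))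

NMDist : (N : ℕ) → (Fin N → Fin N → Bool) → (p q : Fin N → ℚ) →
         (f g : Fin N → Fin N) → ℚ
NMDist N nmE p q f g =
  ½ * ΣB (λ α → ΣB (λ β →
    ∣ PrJoint N nmE p q f g α β - ½ * PrTampered N nmE p q f g β ∣))

IsNMExtractor : (N : ℕ) (K ε : ℚ) → (Fin N → Fin N → Bool) → Set
IsNMExtractor N K ε nmE =
  ∀ (p q : Fin N → ℚ) → IsSource N K p → IsSource N K q →
  ∀ (f g : Fin N → Fin N) → NoFixedPoints f → NoFixedPoints g →
  NMDist N nmE p q f g ≤ ε

IsNMExtractorPerm : (N : ℕ) (K ε : ℚ) → (Fin N → Fin N → Bool) → Set
IsNMExtractorPerm N K ε nmE =
  ∀ (p q : Fin N → ℚ) → IsSource N K p → IsSource N K q →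
  ∀ (f g : Fin N ↔ Fin N) →
  NoFixedPoints (Inverse.to f) → NoFixedPoints (Inverse.to g) →
  NMDist N nmE p q (Inverse.to f) (Inverse.to g) ≤ ε

IsQuasiOrthogonal : (N : ℕ) (ε : ℚ) → (Fin N → Fin N → Bool) → Set
IsQuasiOrthogonal N ε nmE =
  (∀ x σ → count N (λ y → nmE x y ==B σ) ≤ (½ + ε) * toℚ N) ×
  (∀ y σ → count N (λ x → nmE x y ==B σ) ≤ (½ + ε) * toℚ N) ×
  (∀ x x' → x ≢ x' →
     (½ - ε) * toℚ N ≤ count N (λ y → not (nmE x y ==B nmE x' y))) ×
  (∀ y y' → y ≢ y' →
     (½ - ε) * toℚ N ≤ count N (λ x → not (nmE x y ==B nmE x y')))

-- Graphs on the vertex set V = {0,1} × [N]  (⟨σ,i⟩ ↦ (σ , i), true = 1),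
-- given by a boolean adjacency function on ordered pairs.

V : ℕ → Set
V N = Bool × Fin N

ΣV : (N : ℕ) → (V N → ℚ) → ℚ
ΣV N h = ΣB (λ σ → Σℚ N (λ i → h (σ , i)))

_==V_ : {N : ℕ} → V N → V N → Bool
(σ , i) ==V (τ , j) = (σ ==B τ) Data.Bool.∧ (i ==F j)

Gadj : (N : ℕ) → (Fin N → Fin N → Bool) → V N → V N → Bool
Gadj N nmE (true  , i) (false , j) = nmE i j
Gadj N nmE (false , j) (true  , i) = nmE i j
Gadj N nmE (true  , i) (true  , i') = not (i ==F i')
Gadj N nmE (false , _) (false , _) = false

-- |E △ π(E)| for a loopless symmetric adjacency relation: the number of
-- ordered pairs (a,b) on which E and π(E) = {{π u, π v} : {u,v} ∈ E}
-- disagree, divided by 2 (each unordered pair is counted twice; there are no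
-- loops since adj is irreflexive and π is a bijection).
SymDiffSize : (N : ℕ) → (V N → V N → Bool) → (V N ↔ V N) → ℚ
SymDiffSize N adj π =
  ½ * ΣV N (λ a → ΣV N (λ b →
    𝟙 (adj a b xor adj (Inverse.from π a) (Inverse.from π b))))

Moved : (N : ℕ) → (V N ↔ V N) → ℚ
Moved N π = ΣV N (λ v → 𝟙 (not (Inverse.to π v ==V v)))

RobustlySelfOrdered : (N : ℕ) → (V N → V N → Bool) → ℚ → Set
RobustlySelfOrdered N adj ρ =
  ∀ (π : V N ↔ V N) → ρ * Moved N π ≤ SymDiffSize N adj π

{-# OPTIONS --safe #-}
module Submission where

-- Let π permute the vertices, σ = π⁻¹ and δ = ½ - ε. Vertices of V₁ have degree at least
-- 2^ℓ - 1 and vertices of V₀ at most (½ + ε) 2^ℓ, so each vertex that σ moves to the other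
-- side has about δ 2^ℓ neighbours on which G and π(G) disagree. A vertex moved within its
-- side has, by quasi-orthogonality, at least δ 2^ℓ such neighbours minus the number of moved
-- vertices of the other side. When that correction is large on both sides, many vertices are
-- moved within both sides; on a third of them σ agrees with derangements f, g, and
-- non-malleability for the uniform sources on these sets P, Q yields δ |P| |Q| disagreements.
-- A case analysis on the numbers of crossing and shifted vertices gives
-- |E △ π(E)| ≥ (δ³ / 64) 2^ℓ |{v : π v ≠ v}|.

open import Defs
open import Data.Bool using (Bool; true; false; not; _∧_; _∨_; _xor_; T)
open import Data.Bool.Properties using (T-∧; T-not-≡)
open import Data.Empty using (⊥; ⊥-elim)
open import Data.Fin as F using (Fin; _≟_)
import Data.Fin.Properties as F
open import Data.Fin.Permutation as Perm using (Permutation′; _∘ₚ_; _⟨$⟩ʳ_)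
import Data.Fin.Permutation.Components as PC
open import Data.Integer as ℤ using (+_)
import Data.Integer.Properties as ℤ
open import Data.List using (List; []; _∷_; _++_; length; filter; allFin)
open import Data.List.Membership.Propositional using (_∈_; _∉_)
open import Data.List.Membership.Propositional.Properties using (∈-++⁺ˡ; ∈-++⁺ʳ; ∈-filter⁺; ∈-filter⁻; ∈-allFin)
open import Data.List.Relation.Unary.All as All using (All; []; _∷_; all?)
open import Data.List.Relation.Unary.All.Properties using (All¬⇒¬Any; ¬All⇒Any¬)
open import Data.List.Relation.Unary.AllPairs using ([]; _∷_)
open import Data.List.Relation.Unary.Any as Any using (Any; here; there; any?)
open import Data.List.Relation.Unary.Unique.Propositional using (Unique)
open import Data.List.Relation.Unary.Unique.Propositional.Properties using (++⁺; filter⁺; allFin⁺)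
open import Data.Nat as ℕ using (ℕ; zero; suc)
open import Data.Product using (_×_; _,_; proj₁; proj₂; Σ)
open import Data.Rational hiding (_≟_)
open import Data.Rational.Properties hiding (_≟_)
open import Algebra.Properties.CommutativeMonoid.Sum +-0-commutativeMonoid using (sum; sum-permute)
open import Data.Rational.Solver using (module +-*-Solver)
import Data.Rational.Unnormalised as ℚᵘ
import Data.Rational.Unnormalised.Properties as ℚᵘ
open import Data.Sum using (_⊎_; inj₁; inj₂)
open import Data.Unit using (tt)
open import Function using (_∘_; _↔_; Inverse; Equivalence)
open import Function.Bundles using (mk↔ₛ′)
open import Function.Properties.Inverse using (↔-sym; ↔-trans)
open import Relation.Binary.PropositionalEquality
open import Relation.Nullary using (¬_; Dec; does; yes; no)
open import Relation.Nullary.Decidable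
  using (dec-true; dec-false; decidable-stable; T?; ¬?; _×-dec_; _⊎-dec_)

open +-*-Solver

≤-compute : {p q : ℚ} {t : T (p ≤ᵇ q)} → p ≤ q
≤-compute {t = t} = ≤ᵇ⇒≤ t

0≤-literal : ∀ k {t : T (0ℚ ≤ᵇ k)} → 0ℚ ≤ k
0≤-literal k {t} = ≤ᵇ⇒≤ t

0≤q-p⇒p≤q : {p q : ℚ} → 0ℚ ≤ q - p → p ≤ q
0≤q-p⇒p≤q {p} {q} h = begin
  p             ≡⟨ solve 1 (λ p → p := p :+ con 0ℚ) refl p ⟩
  p + 0ℚ        ≤⟨ +-monoʳ-≤ p h ⟩
  p + (q - p)   ≡⟨ solve 2 (λ p q → p :+ (q :- p) := q) refl p q ⟩
  q             ∎
  where open ≤-Reasoning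

p≤q⇒0≤q-p : {p q : ℚ} → p ≤ q → 0ℚ ≤ q - p
p≤q⇒0≤q-p {p} {q} h = ≤-trans (≤-reflexive (sym (+-inverseʳ p))) (+-monoˡ-≤ (- p) h)

≤-byDifference : {p q : ℚ} (d : ℚ) → 0ℚ ≤ d → q - p ≡ d → p ≤ q
≤-byDifference d 0≤d eq = 0≤q-p⇒p≤q (≤-trans 0≤d (≤-reflexive (sym eq)))

+-nonNeg : {p q : ℚ} → 0ℚ ≤ p → 0ℚ ≤ q → 0ℚ ≤ p + q
+-nonNeg = +-mono-≤

*-nonNeg : {p q : ℚ} → 0ℚ ≤ p → 0ℚ ≤ q → 0ℚ ≤ p * q
*-nonNeg {p} {q} 0≤p 0≤q =
  ≤-trans (≤-reflexive (sym (*-zeroʳ p))) (*-monoˡ-≤-nonNeg p {{nonNegative 0≤p}} 0≤q)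

*-pos : {p q : ℚ} → 0ℚ < p → 0ℚ < q → 0ℚ < p * q
*-pos {p} {q} 0<p 0<q = positive⁻¹ (p * q) {{pos*pos⇒pos p {{positive 0<p}} q {{positive 0<q}}}}

*-monoˡ-≤-0≤ : {r p q : ℚ} → 0ℚ ≤ r → p ≤ q → r * p ≤ r * q
*-monoˡ-≤-0≤ {r} 0≤r = *-monoˡ-≤-nonNeg r {{nonNegative 0≤r}}

*-monoʳ-≤-0≤ : {r p q : ℚ} → 0ℚ ≤ r → p ≤ q → p * r ≤ q * r
*-monoʳ-≤-0≤ {r} 0≤r = *-monoʳ-≤-nonNeg r {{nonNegative 0≤r}}

*-mono-≤-0≤ : {a b c d : ℚ} → 0ℚ ≤ a → 0ℚ ≤ c → a ≤ b → c ≤ d → a * c ≤ b * d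
*-mono-≤-0≤ 0≤a 0≤c a≤b c≤d =
  ≤-trans (*-monoˡ-≤-0≤ 0≤a c≤d) (*-monoʳ-≤-0≤ (≤-trans 0≤c c≤d) a≤b)

p-q≤r⇒p-r≤q : {p q r : ℚ} → p - q ≤ r → p - r ≤ q
p-q≤r⇒p-r≤q {p} {q} {r} h = 0≤q-p⇒p≤q (≤-trans (p≤q⇒0≤q-p h)
  (≤-reflexive (solve 3 (λ p q r → r :- (p :- q) := q :- (p :- r)) refl p q r)))

p-q≤r⇒p≤q+r : {p q r : ℚ} → p - q ≤ r → p ≤ q + r
p-q≤r⇒p≤q+r {p} {q} {r} h = 0≤q-p⇒p≤q (≤-trans (p≤q⇒0≤q-p h)
  (≤-reflexive (solve 3 (λ p q r → r :- (p :- q) := (q :+ r) :- p) refl p q r)))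

p≤∣p∣ : ∀ p → p ≤ ∣ p ∣
p≤∣p∣ p with ∣p∣≡p∨∣p∣≡-p p
... | inj₁ ∣p∣≡p = ≤-reflexive (sym ∣p∣≡p)
... | inj₂ ∣p∣≡-p = ≤-trans p≤0 (0≤∣p∣ p)
  where
  p≤0 : p ≤ 0ℚ
  p≤0 = 0≤q-p⇒p≤q (≤-trans (0≤∣p∣ p)
          (≤-reflexive (trans ∣p∣≡-p (solve 1 (λ p → :- p := con 0ℚ :- p) refl p))))

-p≤∣p∣ : ∀ p → - p ≤ ∣ p ∣
-p≤∣p∣ p = ≤-trans (p≤∣p∣ (- p)) (≤-reflexive (∣-p∣≡∣p∣ p))

toℚ-suc : ∀ n → toℚ (suc n) ≡ 1ℚ + toℚ n
toℚ-suc n = toℚᵘ-injective (ℚᵘ.≃-trans (toℚᵘ-fromℚᵘ (ℚᵘ.mkℚᵘ (+ suc n) 0))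
  (ℚᵘ.≃-trans unnormalised (ℚᵘ.≃-sym (ℚᵘ.≃-trans (toℚᵘ-homo-+ 1ℚ (toℚ n))
    (ℚᵘ.+-cong (toℚᵘ-fromℚᵘ (ℚᵘ.mkℚᵘ (+ 1) 0)) (toℚᵘ-fromℚᵘ (ℚᵘ.mkℚᵘ (+ n) 0)))))))
  where
  unnormalised : ℚᵘ.mkℚᵘ (+ suc n) 0 ℚᵘ.≃ (ℚᵘ.mkℚᵘ (+ 1) 0 ℚᵘ.+ ℚᵘ.mkℚᵘ (+ n) 0)
  unnormalised = ℚᵘ.*≡* (cong (ℤ._* + 1)
    (sym (cong₂ ℤ._+_ (ℤ.*-identityʳ (+ 1)) (ℤ.*-identityʳ (+ n)))))

Σ-cong : ∀ n {f g : Fin n → ℚ} → (∀ i → f i ≡ g i) → Σℚ n f ≡ Σℚ n g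
Σ-cong zero    f≗g = refl
Σ-cong (suc n) f≗g = cong₂ _+_ (f≗g F.zero) (Σ-cong n (f≗g ∘ F.suc))

Σ-mono-≤ : ∀ n {f g : Fin n → ℚ} → (∀ i → f i ≤ g i) → Σℚ n f ≤ Σℚ n g
Σ-mono-≤ zero    f≤g = ≤-refl
Σ-mono-≤ (suc n) f≤g = +-mono-≤ (f≤g F.zero) (Σ-mono-≤ n (f≤g ∘ F.suc))

Σ-zero : ∀ n → Σℚ n (λ _ → 0ℚ) ≡ 0ℚ
Σ-zero zero    = refl
Σ-zero (suc n) = trans (+-identityˡ _) (Σ-zero n)

Σ-one : ∀ n → Σℚ n (λ _ → 1ℚ) ≡ toℚ n
Σ-one zero    = refl
Σ-one (suc n) = trans (cong (_+_ 1ℚ) (Σ-one n)) (sym (toℚ-suc n))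

Σ-+ : ∀ n (f g : Fin n → ℚ) → Σℚ n (λ i → f i + g i) ≡ Σℚ n f + Σℚ n g
Σ-+ zero    f g = refl
Σ-+ (suc n) f g = trans (cong (_+_ (f F.zero + g F.zero)) (Σ-+ n (f ∘ F.suc) (g ∘ F.suc)))
  (solve 4 (λ a b c d → (a :+ b) :+ (c :+ d) := (a :+ c) :+ (b :+ d)) refl
     (f F.zero) (g F.zero) (Σℚ n (f ∘ F.suc)) (Σℚ n (g ∘ F.suc)))

Σ-sub : ∀ n (f g : Fin n → ℚ) → Σℚ n (λ i → f i - g i) ≡ Σℚ n f - Σℚ n g
Σ-sub zero    f g = refl
Σ-sub (suc n) f g = trans (cong (_+_ (f F.zero - g F.zero)) (Σ-sub n (f ∘ F.suc) (g ∘ F.suc)))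
  (solve 4 (λ a b c d → (a :- b) :+ (c :- d) := (a :+ c) :- (b :+ d)) refl
     (f F.zero) (g F.zero) (Σℚ n (f ∘ F.suc)) (Σℚ n (g ∘ F.suc)))

Σ-*ˡ : ∀ n c (f : Fin n → ℚ) → Σℚ n (λ i → c * f i) ≡ c * Σℚ n f
Σ-*ˡ zero    c f = sym (*-zeroʳ c)
Σ-*ˡ (suc n) c f = trans (cong (_+_ (c * f F.zero)) (Σ-*ˡ n c (f ∘ F.suc)))
  (sym (*-distribˡ-+ c (f F.zero) (Σℚ n (f ∘ F.suc))))

Σ-*ʳ : ∀ n c (f : Fin n → ℚ) → Σℚ n (λ i → f i * c) ≡ Σℚ n f * c
Σ-*ʳ n c f = trans (Σ-cong n (λ i → *-comm (f i) c)) (trans (Σ-*ˡ n c f) (*-comm c _))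

Σ-nonNeg : ∀ n {f : Fin n → ℚ} → (∀ i → 0ℚ ≤ f i) → 0ℚ ≤ Σℚ n f
Σ-nonNeg n 0≤f = ≤-trans (≤-reflexive (sym (Σ-zero n))) (Σ-mono-≤ n 0≤f)

toℚ-nonNeg : ∀ n → 0ℚ ≤ toℚ n
toℚ-nonNeg n = ≤-trans (Σ-nonNeg n (λ _ → ≤-compute)) (≤-reflexive (Σ-one n))

Σ-point : ∀ n (z : Fin n) (h : Fin n → ℚ) → Σℚ n (λ x → 𝟙 (x ==F z) * h x) ≡ h z
Σ-point (suc n) F.zero h = trans
  (cong₂ _+_ (*-identityˡ (h F.zero)) (trans (Σ-cong n (λ x → *-zeroˡ (h (F.suc x)))) (Σ-zero n)))
  (+-identityʳ (h F.zero))
Σ-point (suc n) (F.suc z) h = trans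
  (cong₂ _+_ (*-zeroˡ (h F.zero)) (Σ-point n z (h ∘ F.suc)))
  (+-identityˡ (h (F.suc z)))

𝟙-nonNeg : ∀ b → 0ℚ ≤ 𝟙 b
𝟙-nonNeg true  = ≤-compute
𝟙-nonNeg false = ≤-compute

𝟙-≤1 : ∀ b → 𝟙 b ≤ 1ℚ
𝟙-≤1 true  = ≤-compute
𝟙-≤1 false = ≤-compute

𝟙-not : ∀ b → 𝟙 (not b) ≡ 1ℚ - 𝟙 b
𝟙-not true  = refl
𝟙-not false = refl

𝟙-mono : ∀ {a b} → (T a → T b) → 𝟙 a ≤ 𝟙 b
𝟙-mono {true}  {true}  _   = ≤-compute
𝟙-mono {true}  {false} a⇒b = ⊥-elim (a⇒b tt)
𝟙-mono {false} {b}     _   = 𝟙-nonNeg b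

𝟙-∨-disjoint : ∀ a b → ¬ (T a × T b) → 𝟙 (a ∨ b) ≡ 𝟙 a + 𝟙 b
𝟙-∨-disjoint true  true  disj = ⊥-elim (disj (tt , tt))
𝟙-∨-disjoint true  false _    = refl
𝟙-∨-disjoint false b     _    = sym (+-identityˡ (𝟙 b))

𝟙-∨-≤ : ∀ a b → 𝟙 (a ∨ b) ≤ 𝟙 a + 𝟙 b
𝟙-∨-≤ true  b = ≤-trans (≤-reflexive (sym (+-identityʳ 1ℚ))) (+-monoʳ-≤ 1ℚ (𝟙-nonNeg b))
𝟙-∨-≤ false b = ≤-reflexive (sym (+-identityˡ (𝟙 b)))

𝟙a-𝟙b≤𝟙[a⊕b] : ∀ a b → 𝟙 a - 𝟙 b ≤ 𝟙 (a xor b)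
𝟙a-𝟙b≤𝟙[a⊕b] true  true  = ≤-compute
𝟙a-𝟙b≤𝟙[a⊕b] true  false = ≤-compute
𝟙a-𝟙b≤𝟙[a⊕b] false true  = ≤-compute
𝟙a-𝟙b≤𝟙[a⊕b] false false = ≤-compute

𝟙b-𝟙a≤𝟙[a⊕b] : ∀ a b → 𝟙 b - 𝟙 a ≤ 𝟙 (a xor b)
𝟙b-𝟙a≤𝟙[a⊕b] true  true  = ≤-compute
𝟙b-𝟙a≤𝟙[a⊕b] true  false = ≤-compute
𝟙b-𝟙a≤𝟙[a⊕b] false true  = ≤-compute
𝟙b-𝟙a≤𝟙[a⊕b] false false = ≤-compute

count-nonNeg : ∀ n P → 0ℚ ≤ count n P
count-nonNeg n P = Σ-nonNeg n (λ i → 𝟙-nonNeg (P i))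

count-≤n : ∀ n P → count n P ≤ toℚ n
count-≤n n P = ≤-trans (Σ-mono-≤ n (λ i → 𝟙-≤1 (P i))) (≤-reflexive (Σ-one n))

count-mono-≤ : ∀ n (P Q : Fin n → Bool) → (∀ i → T (P i) → T (Q i)) → count n P ≤ count n Q
count-mono-≤ n P Q P⇒Q = Σ-mono-≤ n (λ i → 𝟙-mono (P⇒Q i))

count-∨-disjoint : ∀ n (P Q : Fin n → Bool) → (∀ i → ¬ (T (P i) × T (Q i))) →
                   count n (λ i → P i ∨ Q i) ≡ count n P + count n Q
count-∨-disjoint n P Q disj =
  trans (Σ-cong n (λ i → 𝟙-∨-disjoint (P i) (Q i) (disj i))) (Σ-+ n _ _)

count-*ʳ : ∀ n (P : Fin n → Bool) x → Σℚ n (λ i → 𝟙 (P i) * x) ≡ count n P * x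
count-*ʳ n P x = Σ-*ʳ n x (λ i → 𝟙 (P i))

count-none : ∀ n (P : Fin n → Bool) → (∀ i → ¬ T (P i)) → count n P ≡ 0ℚ
count-none n P none = trans (Σ-cong n (λ i → 𝟙-false (P i) (none i))) (Σ-zero n)
  where
  𝟙-false : ∀ b → ¬ T b → 𝟙 b ≡ 0ℚ
  𝟙-false true  ¬b = ⊥-elim (¬b tt)
  𝟙-false false _  = refl

count-≤1 : ∀ n (P : Fin n → Bool) → (∀ x y → T (P x) → T (P y) → x ≡ y) → count n P ≤ 1ℚ
count-≤1 zero    P unique = ≤-compute
count-≤1 (suc n) P unique with P F.zero in eq
... | true  = ≤-reflexive (trans (cong (_+_ 1ℚ) (count-none n (P ∘ F.suc) only-zero)) (+-identityʳ 1ℚ))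
  where
  only-zero : ∀ i → ¬ T (P (F.suc i))
  only-zero i Psi with unique F.zero (F.suc i) (subst T (sym eq) tt) Psi
  ... | ()
... | false = ≤-trans (≤-reflexive (+-identityˡ _))
  (count-≤1 n (P ∘ F.suc) (λ x y Px Py → F.suc-injective (unique (F.suc x) (F.suc y) Px Py)))

does⇒ : {A : Set} (a? : Dec A) → T (does a?) → A
does⇒ (yes a) _ = a

⇒does : {A : Set} (a? : Dec A) → A → T (does a?)
⇒does (yes _)  _ = tt
⇒does (no ¬a) a = ¬a a

==F⇒≡ : ∀ {n} {x y : Fin n} → T (x ==F y) → x ≡ y
==F⇒≡ {x = x} {y} = does⇒ (x ≟ y)

≡⇒==F : ∀ {n} {x y : Fin n} → x ≡ y → T (x ==F y)
≡⇒==F {x = x} {y} = ⇒does (x ≟ y)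

count-point : ∀ n (z : Fin n) → count n (_==F z) ≡ 1ℚ
count-point n z = trans (Σ-cong n (λ x → sym (*-identityʳ (𝟙 (x ==F z))))) (Σ-point n z (λ _ → 1ℚ))

module _ {n : ℕ} where
  open import Data.List.Membership.DecPropositional (F._≟_ {n}) public using (_∈?_)

count-∈ : ∀ {n} (L : List (Fin n)) → Unique L → count n (λ x → does (x ∈? L)) ≡ toℚ (length L)
count-∈ {n} []      _          = count-none n (λ _ → false) (λ _ ())
count-∈ {n} (b ∷ L) (b∉ ∷ uL) = begin
  count n (λ x → (x ==F b) ∨ does (x ∈? L))          ≡⟨ count-∨-disjoint n _ _ b∉L ⟩
  count n (_==F b) + count n (λ x → does (x ∈? L))   ≡⟨ cong₂ _+_ (count-point n b) (count-∈ L uL) ⟩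
  1ℚ + toℚ (length L)                                ≡⟨ toℚ-suc (length L) ⟨
  toℚ (length (b ∷ L))                               ∎
  where
  open ≡-Reasoning
  b∉L : ∀ x → ¬ (T (x ==F b) × T (does (x ∈? L)))
  b∉L x (x≡b , x∈L) = All¬⇒¬Any b∉ (subst (_∈ L) (==F⇒≡ x≡b) (does⇒ (x ∈? L) x∈L))

Σ-++ : ∀ m n (f : Fin (m ℕ.+ n) → ℚ) →
       Σℚ (m ℕ.+ n) f ≡ Σℚ m (λ i → f (i F.↑ˡ n)) + Σℚ n (λ j → f (m F.↑ʳ j))
Σ-++ zero    n f = sym (+-identityˡ _)
Σ-++ (suc m) n f = trans (cong (_+_ (f F.zero)) (Σ-++ m n (f ∘ F.suc)))
  (sym (+-assoc (f F.zero) (Σℚ m (λ i → f (F.suc (i F.↑ˡ n)))) _))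

Σℚ≡sum : ∀ n (f : Fin n → ℚ) → Σℚ n f ≡ sum f
Σℚ≡sum zero    f = refl
Σℚ≡sum (suc n) f = cong (_+_ (f F.zero)) (Σℚ≡sum n (f ∘ F.suc))

Σ²-cong : ∀ N {h k : Fin N → Fin N → ℚ} → (∀ x y → h x y ≡ k x y) →
          Σℚ N (λ x → Σℚ N (h x)) ≡ Σℚ N (λ x → Σℚ N (k x))
Σ²-cong N h≗k = Σ-cong N (λ x → Σ-cong N (h≗k x))

Σ²-+ : ∀ N (h k : Fin N → Fin N → ℚ) →
       Σℚ N (λ x → Σℚ N (λ y → h x y + k x y)) ≡ Σℚ N (λ x → Σℚ N (h x)) + Σℚ N (λ x → Σℚ N (k x))
Σ²-+ N h k = trans (Σ-cong N (λ x → Σ-+ N (h x) (k x))) (Σ-+ N _ _)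

Σ²-*ˡ : ∀ N c (h : Fin N → Fin N → ℚ) →
        Σℚ N (λ x → Σℚ N (λ y → c * h x y)) ≡ c * Σℚ N (λ x → Σℚ N (h x))
Σ²-*ˡ N c h = trans (Σ-cong N (λ x → Σ-*ˡ N c (h x))) (Σ-*ˡ N c _)

Σ²-product : ∀ N (p q : Fin N → ℚ) → Σℚ N (λ x → Σℚ N (λ y → p x * q y)) ≡ Σℚ N p * Σℚ N q
Σ²-product N p q = trans (Σ-cong N (λ x → Σ-*ˡ N (p x) q)) (Σ-*ʳ N (Σℚ N q) p)

ΣV-mono-≤ : ∀ N {h k : V N → ℚ} → (∀ v → h v ≤ k v) → ΣV N h ≤ ΣV N k
ΣV-mono-≤ N h≤k = +-mono-≤ (Σ-mono-≤ N (λ i → h≤k (true , i))) (Σ-mono-≤ N (λ i → h≤k (false , i)))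

ΣV-nonNeg : ∀ N {h : V N → ℚ} → (∀ v → 0ℚ ≤ h v) → 0ℚ ≤ ΣV N h
ΣV-nonNeg N 0≤h = +-nonNeg (Σ-nonNeg N (λ i → 0≤h (true , i))) (Σ-nonNeg N (λ i → 0≤h (false , i)))

ΣV-side-≤ : ∀ N {h : V N → ℚ} → (∀ v → 0ℚ ≤ h v) → ∀ τ → Σℚ N (λ j → h (τ , j)) ≤ ΣV N h
ΣV-side-≤ N {h} 0≤h true  = ≤-trans (≤-reflexive (sym (+-identityʳ _)))
                              (+-monoʳ-≤ (Σℚ N (λ j → h (true , j))) (Σ-nonNeg N (λ j → 0≤h (false , j))))
ΣV-side-≤ N {h} 0≤h false = ≤-trans (≤-reflexive (sym (+-identityˡ _)))
                              (+-monoˡ-≤ (Σℚ N (λ j → h (false , j))) (Σ-nonNeg N (λ j → 0≤h (true , j))))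

ΣV-sub : ∀ N (h k : V N → ℚ) → ΣV N (λ v → h v - k v) ≡ ΣV N h - ΣV N k
ΣV-sub N h k = trans
  (cong₂ _+_ (Σ-sub N (λ i → h (true , i)) (λ i → k (true , i))) (Σ-sub N (λ i → h (false , i)) (λ i → k (false , i))))
  (solve 4 (λ a b c d → (a :- b) :+ (c :- d) := (a :+ c) :- (b :+ d)) refl
     (Σℚ N (λ i → h (true , i))) (Σℚ N (λ i → k (true , i)))
     (Σℚ N (λ i → h (false , i))) (Σℚ N (λ i → k (false , i))))

module _ {N : ℕ} where
  private
    encode : V N → Fin (N ℕ.+ N)
    encode (true  , i) = i F.↑ˡ N
    encode (false , j) = N F.↑ʳ j

    fromSum : Fin N ⊎ Fin N → V N
    fromSum (inj₁ i) = true , i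
    fromSum (inj₂ j) = false , j

    decode : Fin (N ℕ.+ N) → V N
    decode k = fromSum (F.splitAt N k)

    decode-encode : ∀ v → decode (encode v) ≡ v
    decode-encode (true  , i) = cong fromSum (F.splitAt-↑ˡ N i N)
    decode-encode (false , j) = cong fromSum (F.splitAt-↑ʳ N N j)

    encode-decode : ∀ k → encode (decode k) ≡ k
    encode-decode k = trans (encode-fromSum (F.splitAt N k)) (F.join-splitAt N N k)
      where
      encode-fromSum : ∀ s → encode (fromSum s) ≡ F.join N N s
      encode-fromSum (inj₁ i) = refl
      encode-fromSum (inj₂ j) = refl

    V↔Fin : V N ↔ Fin (N ℕ.+ N)
    V↔Fin = mk↔ₛ′ encode decode encode-decode decode-encode

    ΣV≡Σℚ : ∀ h → ΣV N h ≡ Σℚ (N ℕ.+ N) (h ∘ decode)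
    ΣV≡Σℚ h = sym (trans (Σ-++ N N (h ∘ decode))
      (cong₂ _+_ (Σ-cong N (λ i → cong h (decode-encode (true , i))))
                 (Σ-cong N (λ j → cong h (decode-encode (false , j))))))

  ΣV-permute : (π : V N ↔ V N) (h : V N → ℚ) → ΣV N (h ∘ Inverse.to π) ≡ ΣV N h
  ΣV-permute π h = begin
    ΣV N (h ∘ Inverse.to π)                          ≡⟨ ΣV≡Σℚ (h ∘ Inverse.to π) ⟩
    Σℚ (N ℕ.+ N) (h ∘ Inverse.to π ∘ decode)         ≡⟨ Σ-cong (N ℕ.+ N) (λ k → cong h (sym (decode-encode _))) ⟩
    Σℚ (N ℕ.+ N) (h ∘ decode ∘ Inverse.to πFin)      ≡⟨ Σℚ≡sum (N ℕ.+ N) _ ⟩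
    sum (h ∘ decode ∘ Inverse.to πFin)               ≡⟨ sum-permute (h ∘ decode) πFin ⟨
    sum (h ∘ decode)                                 ≡⟨ Σℚ≡sum (N ℕ.+ N) _ ⟨
    Σℚ (N ℕ.+ N) (h ∘ decode)                        ≡⟨ ΣV≡Σℚ h ⟨
    ΣV N h                                           ∎
    where
    open ≡-Reasoning
    πFin : Fin (N ℕ.+ N) ↔ Fin (N ℕ.+ N)
    πFin = ↔-trans (↔-sym V↔Fin) (↔-trans π V↔Fin)

-- Cyclic permutations of Fin n

module _ {n : ℕ} where

  transpose-matchˡ : (i j : Fin n) → PC.transpose i j i ≡ j
  transpose-matchˡ i j rewrite dec-true (i ≟ i) refl = refl

  transpose-matchʳ : (i j : Fin n) → PC.transpose i j j ≡ i
  transpose-matchʳ i j with j ≟ i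
  ... | yes j≡i = j≡i
  ... | no  _   rewrite dec-true (j ≟ j) refl = refl

  transpose-other : (i j k : Fin n) → k ≢ i → k ≢ j → PC.transpose i j k ≡ k
  transpose-other i j k k≢i k≢j rewrite dec-false (k ≟ i) k≢i | dec-false (k ≟ j) k≢j = refl

  -- on a list a₁ … aₖ of distinct elements: aᵢ ↦ aᵢ₊₁ and aₖ ↦ a₁
  rotate : List (Fin n) → Fin n → Fin n
  rotate []          x = x
  rotate (a ∷ [])    x = x
  rotate (a ∷ b ∷ r) x = PC.transpose a b (rotate (b ∷ r) x)

  cycle : List (Fin n) → Permutation′ n
  cycle []          = Perm.id
  cycle (a ∷ [])    = Perm.id
  cycle (a ∷ b ∷ r) = cycle (b ∷ r) ∘ₚ Perm.transpose a b

  cycle-apply : ∀ L x → cycle L ⟨$⟩ʳ x ≡ rotate L x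
  cycle-apply []          x = refl
  cycle-apply (a ∷ [])    x = refl
  cycle-apply (a ∷ b ∷ r) x = cong (PC.transpose a b) (cycle-apply (b ∷ r) x)

  data Consecutive : List (Fin n) → Fin n → Fin n → Set where
    at-head : ∀ {a b r} → Consecutive (a ∷ b ∷ r) a b
    in-tail : ∀ {c L a b} → Consecutive L a b → Consecutive (c ∷ L) a b

  consecutive-∈ : ∀ {L a b} → Consecutive L a b → b ∈ L
  consecutive-∈ at-head     = there (here refl)
  consecutive-∈ (in-tail c) = there (consecutive-∈ c)

  consecutive-∈-tail : ∀ {d r a b} → Consecutive (d ∷ r) a b → b ∈ r
  consecutive-∈-tail at-head     = here refl
  consecutive-∈-tail (in-tail c) = consecutive-∈ c

  consecutive-++ : ∀ {xs ys a b} → Consecutive xs a b → Consecutive (xs ++ ys) a b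
  consecutive-++ at-head     = at-head
  consecutive-++ (in-tail c) = in-tail (consecutive-++ c)

  rotate-outside : ∀ L x → x ∉ L → rotate L x ≡ x
  rotate-outside []          x _   = refl
  rotate-outside (a ∷ [])    x _   = refl
  rotate-outside (a ∷ b ∷ r) x x∉L =
    trans (cong (PC.transpose a b) (rotate-outside (b ∷ r) x (x∉L ∘ there)))
          (transpose-other a b x (x∉L ∘ here) (x∉L ∘ there ∘ here))

  rotate-head : ∀ a b r → Unique (a ∷ b ∷ r) → rotate (a ∷ b ∷ r) a ≡ b
  rotate-head a b r (a∉ ∷ _) =
    trans (cong (PC.transpose a b) (rotate-outside (b ∷ r) a (All¬⇒¬Any a∉))) (transpose-matchˡ a b)

  rotate-consecutive : ∀ L {a b} → Unique L → Consecutive L a b → rotate L a ≡ b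
  rotate-consecutive (a ∷ b ∷ r) u at-head = rotate-head a b r u
  rotate-consecutive (c ∷ d ∷ r) {a} {b} (c∉ ∷ u@(d∉ ∷ _)) (in-tail cons) =
    trans (cong (PC.transpose c d) (rotate-consecutive (d ∷ r) u cons)) (transpose-other c d b b≢c b≢d)
    where
    b≢c : b ≢ c
    b≢c refl = All¬⇒¬Any c∉ (consecutive-∈ cons)
    b≢d : b ≢ d
    b≢d refl = All¬⇒¬Any d∉ (consecutive-∈-tail cons)

  rotate-∈ : ∀ L {x} → Unique L → x ∈ L → rotate L x ∈ L
  rotate-∈ (a ∷ [])    _ x∈ = x∈
  rotate-∈ (a ∷ b ∷ r) u (here refl) = subst (_∈ a ∷ b ∷ r) (sym (rotate-head a b r u)) (there (here refl))
  rotate-∈ (a ∷ b ∷ r) {x} (a∉ ∷ u) (there x∈) with rotate (b ∷ r) x | rotate-∈ (b ∷ r) u x∈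
  ... | y | y∈ with y ≟ b
  ...   | yes refl = subst (_∈ a ∷ b ∷ r) (sym (transpose-matchʳ a b)) (here refl)
  ...   | no  y≢b  = subst (_∈ a ∷ b ∷ r) (sym (transpose-other a b y y≢a y≢b)) (there y∈)
    where
    y≢a : y ≢ a
    y≢a refl = All¬⇒¬Any a∉ y∈

  rotate-moves : ∀ a b r {x} → Unique (a ∷ b ∷ r) → x ∈ a ∷ b ∷ r → rotate (a ∷ b ∷ r) x ≢ x
  rotate-moves a b r u@(a∉ ∷ _) (here refl) eq =
    All¬⇒¬Any a∉ (subst (_∈ b ∷ r) (trans (sym (rotate-head a b r u)) eq) (here refl))
  rotate-moves a b [] (a∉ ∷ _) (there (here refl)) eq =
    All¬⇒¬Any a∉ (here (trans (sym (transpose-matchʳ a b)) eq))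
  rotate-moves a b (c ∷ r) {x} (a∉ ∷ u) (there x∈) eq
    with rotate (b ∷ c ∷ r) x | rotate-∈ (b ∷ c ∷ r) u x∈ | rotate-moves b c r u x∈
  ... | y | y∈ | y≢x with y ≟ b
  ...   | yes refl = All¬⇒¬Any a∉ (subst (_∈ b ∷ c ∷ r) (trans (sym eq) (transpose-matchʳ a b)) x∈)
  ...   | no  y≢b  = y≢x (trans (sym (transpose-other a b y y≢a y≢b)) eq)
    where
    y≢a : y ≢ a
    y≢a refl = All¬⇒¬Any a∉ y∈

  cycle-derangement : ∀ L → Unique L → (∀ x → x ∈ L) → (z₁ z₂ : Fin n) → z₁ ≢ z₂ →
                      NoFixedPoints (Inverse.to (cycle L))
  cycle-derangement []          _ every z₁ z₂ _ x _ with every z₁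
  ... | ()
  cycle-derangement (c ∷ [])    _ every z₁ z₂ z₁≢z₂ x _ with every z₁ | every z₂
  ... | here refl | here refl = z₁≢z₂ refl
  cycle-derangement (a ∷ b ∷ r) u every z₁ z₂ _ x eq =
    rotate-moves a b r u (every x) (trans (sym (cycle-apply (a ∷ b ∷ r) x)) eq)

-- Derangements extending a partial injection

record AgreeingDerangement {n : ℕ} (S : Fin n → Bool) (f : Fin n → Fin n) : Set where
  field
    domain      : Fin n → Bool
    perm        : Fin n ↔ Fin n
    derangement : NoFixedPoints (Inverse.to perm)
    domain⊆S    : ∀ x → T (domain x) → T (S x)
    agrees      : ∀ x → T (domain x) → Inverse.to perm x ≡ f x
    large       : count n S ≤ toℚ 3 * count n domain

module _ {n : ℕ} (S : Fin n → Bool) (f : Fin n → Fin n)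
         (f-moves : ∀ x → T (S x) → f x ≢ x)
         (f-injective : ∀ x y → T (S x) → T (S y) → f x ≡ f y → x ≡ y) where

  -- x cannot be added to a selection containing b
  Clash : Fin n → Fin n → Set
  Clash x b = x ≡ b ⊎ f x ≡ b ⊎ x ≡ f b

  clash? : ∀ x b → Dec (Clash x b)
  clash? x b = x ≟ b ⊎-dec (f x ≟ b ⊎-dec x ≟ f b)

  Addable : List (Fin n) → Fin n → Set
  Addable acc x = T (S x) × All (¬_ ∘ Clash x) acc

  addable? : ∀ acc x → Dec (Addable acc x)
  addable? acc x = T? (S x) ×-dec all? (λ b → ¬? (clash? x b)) acc

  greedy : List (Fin n) → List (Fin n) → List (Fin n)
  greedy acc []       = acc
  greedy acc (x ∷ xs) with addable? acc x
  ... | yes _ = greedy (x ∷ acc) xs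
  ... | no  _ = greedy acc xs

  pairs : List (Fin n) → List (Fin n)
  pairs []       = []
  pairs (a ∷ as) = a ∷ f a ∷ pairs as

  Valid : List (Fin n) → Set
  Valid acc = All (T ∘ S) acc × Unique acc × Unique (pairs acc)

  avoids-pairs : ∀ {y} L → All (λ b → y ≢ b × y ≢ f b) L → All (y ≢_) (pairs L)
  avoids-pairs []      []                 = []
  avoids-pairs (b ∷ L) ((y≢b , y≢fb) ∷ h) = y≢b ∷ y≢fb ∷ avoids-pairs L h

  valid-∷ : ∀ {acc x} → Valid acc → Addable acc x → Valid (x ∷ acc)
  valid-∷ {acc} {x} (inS , uacc , upairs) (Sx , noClash) =
    (Sx ∷ inS) , (All.map (λ ¬c e → ¬c (inj₁ e)) noClash ∷ uacc) ,
    (x≢fx ∷ avoids-pairs acc (All.map x-avoids noClash)) ∷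
    avoids-pairs acc (All.map fx-avoids (All.zip (inS , noClash))) ∷ upairs
    where
    x≢fx : x ≢ f x
    x≢fx e = f-moves x Sx (sym e)
    x-avoids : ∀ {b} → ¬ Clash x b → x ≢ b × x ≢ f b
    x-avoids ¬c = (λ e → ¬c (inj₁ e)) , (λ e → ¬c (inj₂ (inj₂ e)))
    fx-avoids : ∀ {b} → T (S b) × ¬ Clash x b → f x ≢ b × f x ≢ f b
    fx-avoids {b} (Sb , ¬c) = (λ e → ¬c (inj₂ (inj₁ e))) , (λ e → ¬c (inj₁ (f-injective x b Sx Sb e)))

  greedy-valid : ∀ acc xs → Valid acc → Valid (greedy acc xs)
  greedy-valid acc []       v = v
  greedy-valid acc (x ∷ xs) v with addable? acc x
  ... | yes ok = greedy-valid (x ∷ acc) xs (valid-∷ v ok)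
  ... | no  _  = greedy-valid acc xs v

  greedy-⊇ : ∀ {P : Fin n → Set} acc xs → Any P acc → Any P (greedy acc xs)
  greedy-⊇ acc []       p = p
  greedy-⊇ acc (x ∷ xs) p with addable? acc x
  ... | yes _ = greedy-⊇ (x ∷ acc) xs (there p)
  ... | no  _ = greedy-⊇ acc xs p

  greedy-blocks : ∀ acc xs {x} → x ∈ xs → T (S x) → Any (Clash x) (greedy acc xs)
  greedy-blocks acc (y ∷ xs) (here refl) Sy with addable? acc y
  ... | yes _ = greedy-⊇ (y ∷ acc) xs (here (inj₁ refl))
  ... | no ¬ok = greedy-⊇ acc xs (Any.map (decidable-stable (clash? y _))
                   (¬All⇒Any¬ (λ b → ¬? (clash? y b)) acc (λ noClash → ¬ok (Sy , noClash))))
  greedy-blocks acc (y ∷ xs) (there x∈) Sx with addable? acc y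
  ... | yes _ = greedy-blocks (y ∷ acc) xs x∈ Sx
  ... | no  _ = greedy-blocks acc xs x∈ Sx

  chosen : List (Fin n)
  chosen = greedy [] (allFin n)

  chosen-valid : Valid chosen
  chosen-valid = greedy-valid [] (allFin n) ([] , [] , [])

  -- each chosen b blocks at most three elements of S: b itself, f⁻¹ b and f b
  count-clash-≤3 : ∀ b → count n (λ x → S x ∧ does (clash? x b)) ≤ toℚ 3
  count-clash-≤3 b = begin
    count n (λ x → S x ∧ does (clash? x b))
      ≤⟨ Σ-mono-≤ n (λ x → clash-indicator (S x) (x ==F b) (f x ==F b) (x ==F f b)) ⟩
    Σℚ n (λ x → 𝟙 (x ==F b) + (𝟙 (S x ∧ (f x ==F b)) + 𝟙 (x ==F f b)))
      ≡⟨ trans (Σ-+ n _ _) (cong (_+_ (count n (_==F b))) (Σ-+ n _ _)) ⟩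
    count n (_==F b) + (count n (λ x → S x ∧ (f x ==F b)) + count n (_==F f b))
      ≤⟨ +-mono-≤ (≤-reflexive (count-point n b))
           (+-mono-≤ (count-≤1 n _ preimage-unique) (≤-reflexive (count-point n (f b)))) ⟩
    1ℚ + (1ℚ + 1ℚ)
      ≡⟨⟩
    toℚ 3 ∎
    where
    open ≤-Reasoning
    clash-indicator : ∀ s p q r → 𝟙 (s ∧ (p ∨ (q ∨ r))) ≤ 𝟙 p + (𝟙 (s ∧ q) + 𝟙 r)
    clash-indicator false p q r = +-nonNeg (𝟙-nonNeg p) (+-nonNeg (𝟙-nonNeg false) (𝟙-nonNeg r))
    clash-indicator true  true  q r = ≤-trans (≤-reflexive (sym (+-identityʳ 1ℚ)))
                                        (+-monoʳ-≤ 1ℚ (+-nonNeg (𝟙-nonNeg q) (𝟙-nonNeg r)))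
    clash-indicator true  false q r = ≤-trans (𝟙-∨-≤ q r) (≤-reflexive (sym (+-identityˡ _)))
    preimage-unique : ∀ x y → T (S x ∧ (f x ==F b)) → T (S y ∧ (f y ==F b)) → x ≡ y
    preimage-unique x y hx hy with Equivalence.to T-∧ hx | Equivalence.to T-∧ hy
    ... | Sx , fx≡b | Sy , fy≡b = f-injective x y Sx Sy (trans (==F⇒≡ fx≡b) (sym (==F⇒≡ fy≡b)))

  count-blocked : ∀ L → count n (λ x → S x ∧ does (any? (clash? x) L)) ≤ toℚ 3 * toℚ (length L)
  count-blocked [] = ≤-reflexive (trans
    (count-none n _ (λ x h → proj₂ (Equivalence.to T-∧ h))) (sym (*-zeroʳ (toℚ 3))))
  count-blocked (b ∷ L) = begin
    count n (λ x → S x ∧ (does (clash? x b) ∨ does (any? (clash? x) L)))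
      ≤⟨ Σ-mono-≤ n (λ x → ∧-∨-indicator (S x) _ _) ⟩
    Σℚ n (λ x → 𝟙 (S x ∧ does (clash? x b)) + 𝟙 (S x ∧ does (any? (clash? x) L)))
      ≡⟨ Σ-+ n _ _ ⟩
    count n (λ x → S x ∧ does (clash? x b)) + count n (λ x → S x ∧ does (any? (clash? x) L))
      ≤⟨ +-mono-≤ (count-clash-≤3 b) (count-blocked L) ⟩
    toℚ 3 + toℚ 3 * toℚ (length L)
      ≡⟨ solve 2 (λ t m → t :+ t :* m := t :* (con 1ℚ :+ m)) refl (toℚ 3) (toℚ (length L)) ⟩
    toℚ 3 * (1ℚ + toℚ (length L))
      ≡⟨ cong (_*_ (toℚ 3)) (toℚ-suc (length L)) ⟨
    toℚ 3 * toℚ (length (b ∷ L)) ∎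
    where
    open ≤-Reasoning
    ∧-∨-indicator : ∀ s c a → 𝟙 (s ∧ (c ∨ a)) ≤ 𝟙 (s ∧ c) + 𝟙 (s ∧ a)
    ∧-∨-indicator true  c a = 𝟙-∨-≤ c a
    ∧-∨-indicator false c a = ≤-compute

  S≤3*chosen : count n S ≤ toℚ 3 * count n (λ x → does (x ∈? chosen))
  S≤3*chosen = begin
    count n S
      ≤⟨ count-mono-≤ n _ _ (λ x Sx → Equivalence.from T-∧ (Sx , ⇒does (any? (clash? x) chosen) (greedy-blocks [] (allFin n) (∈-allFin x) Sx))) ⟩
    count n (λ x → S x ∧ does (any? (clash? x) chosen))
      ≤⟨ count-blocked chosen ⟩
    toℚ 3 * toℚ (length chosen)
      ≡⟨ cong (_*_ (toℚ 3)) (count-∈ chosen (proj₁ (proj₂ chosen-valid))) ⟨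
    toℚ 3 * count n (λ x → does (x ∈? chosen)) ∎
    where open ≤-Reasoning

  -- the derangement is the cycle through a₁, f a₁, a₂, f a₂, …, followed by the
  -- remaining elements, where a₁, a₂, … are the chosen elements
  tour : List (Fin n)
  tour = pairs chosen ++ filter (λ x → ¬? (x ∈? pairs chosen)) (allFin n)

  tour-unique : Unique tour
  tour-unique = ++⁺ (proj₂ (proj₂ chosen-valid)) (filter⁺ (λ x → ¬? (x ∈? pairs chosen)) (allFin⁺ n))
    (λ (∈pairs , ∈rest) → proj₂ (∈-filter⁻ (λ x → ¬? (x ∈? pairs chosen)) {xs = allFin n} ∈rest) ∈pairs)

  tour-complete : ∀ x → x ∈ tour
  tour-complete x with x ∈? pairs chosen
  ... | yes x∈ = ∈-++⁺ˡ x∈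
  ... | no  x∉ = ∈-++⁺ʳ (pairs chosen) (∈-filter⁺ (λ x → ¬? (x ∈? pairs chosen)) (∈-allFin x) x∉)

  pairs-consecutive : ∀ L {a} → a ∈ L → Consecutive (pairs L) a (f a)
  pairs-consecutive (b ∷ L) (here refl) = at-head
  pairs-consecutive (b ∷ L) (there a∈)  = in-tail (in-tail (pairs-consecutive L a∈))

  agreeingDerangement : (z₁ z₂ : Fin n) → z₁ ≢ z₂ → AgreeingDerangement S f
  agreeingDerangement z₁ z₂ z₁≢z₂ = record
    { domain      = λ x → does (x ∈? chosen)
    ; perm        = cycle tour
    ; derangement = cycle-derangement tour tour-unique tour-complete z₁ z₂ z₁≢z₂
    ; domain⊆S    = λ x x∈ → All.lookup (proj₁ chosen-valid) (does⇒ (x ∈? chosen) x∈)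
    ; agrees      = λ x x∈ → trans (cycle-apply tour x)
        (rotate-consecutive tour tour-unique (consecutive-++ (pairs-consecutive chosen (does⇒ (x ∈? chosen) x∈))))
    ; large       = S≤3*chosen
    }

-- Non-malleability and the probability of a disagreement

module NonMalleability (N : ℕ) (E : Fin N → Fin N → Bool) (p q : Fin N → ℚ) (f g : Fin N → Fin N) where

  Disagreement : ℚ
  Disagreement = Σℚ N (λ x → Σℚ N (λ y → p x * q y * 𝟙 (E x y xor E (f x) (g y))))

  private
    Joint : Bool → Bool → ℚ
    Joint = PrJoint N E p q f g
    Tampered : Bool → ℚ
    Tampered = PrTampered N E p q f g
    w : Fin N → Fin N → ℚ
    w x y = p x * q y

    𝟙-split : ∀ e c → 𝟙 c ≡ 𝟙 ((e ==B true) ∧ c) + 𝟙 ((e ==B false) ∧ c)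
    𝟙-split true  true  = refl
    𝟙-split true  false = refl
    𝟙-split false true  = refl
    𝟙-split false false = refl

    𝟙-total : ∀ e → 𝟙 (e ==B true) + 𝟙 (e ==B false) ≡ 1ℚ
    𝟙-total true  = refl
    𝟙-total false = refl

    𝟙-xor : ∀ e e′ → 𝟙 ((e ==B true) ∧ (e′ ==B false)) + 𝟙 ((e ==B false) ∧ (e′ ==B true)) ≡ 𝟙 (e xor e′)
    𝟙-xor true  true  = refl
    𝟙-xor true  false = refl
    𝟙-xor false true  = refl
    𝟙-xor false false = refl

  Tampered-split : ∀ β → Tampered β ≡ Joint true β + Joint false β
  Tampered-split β = trans (Σ²-cong N (λ x y → trans
      (cong (w x y *_) (𝟙-split (E x y) (E (f x) (g y) ==B β))) (*-distribˡ-+ (w x y) _ _)))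
    (Σ²-+ N _ _)

  Tampered-total : Σℚ N p ≡ 1ℚ → Σℚ N q ≡ 1ℚ → Tampered true + Tampered false ≡ 1ℚ
  Tampered-total Σp≡1 Σq≡1 = begin
    Tampered true + Tampered false
      ≡⟨ Σ²-+ N _ _ ⟨
    Σℚ N (λ x → Σℚ N (λ y → w x y * 𝟙 (E (f x) (g y) ==B true) + w x y * 𝟙 (E (f x) (g y) ==B false)))
      ≡⟨ Σ²-cong N (λ x y → trans (sym (*-distribˡ-+ (w x y) _ _))
                              (trans (cong (w x y *_) (𝟙-total (E (f x) (g y)))) (*-identityʳ _))) ⟩
    Σℚ N (λ x → Σℚ N (w x))
      ≡⟨ Σ²-product N p q ⟩
    Σℚ N p * Σℚ N q
      ≡⟨ cong₂ _*_ Σp≡1 Σq≡1 ⟩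
    1ℚ ∎
    where open ≡-Reasoning

  Joint-disagree : Joint true false + Joint false true ≡ Disagreement
  Joint-disagree = trans (sym (Σ²-+ N _ _)) (Σ²-cong N (λ x y →
    trans (sym (*-distribˡ-+ (w x y) _ _)) (cong (w x y *_) (𝟙-xor (E x y) (E (f x) (g y))))))

  -- write a, b, c, d for Joint true true, true false, false true, false false; the
  -- tampered marginals are a + c and b + d and the disagreement is b + c
  module _ (Σp≡1 : Σℚ N p ≡ 1ℚ) (Σq≡1 : Σℚ N q ≡ 1ℚ) where
    private
      X : Bool → Bool → ℚ
      X α β = Joint α β - ½ * Tampered β

      ½≡ : ½ ≡ ½ * ((Joint true true + Joint false true) + (Joint true false + Joint false false))
      ½≡ = trans (sym (*-identityʳ ½)) (cong (½ *_) (trans (sym (Tampered-total Σp≡1 Σq≡1))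
             (cong₂ _+_ (Tampered-split true) (Tampered-split false))))

      X≡ : ∀ α β → X α β ≡ Joint α β - ½ * (Joint true β + Joint false β)
      X≡ α β = cong (λ t → Joint α β - ½ * t) (Tampered-split β)

    disagreement-½-≤-NMDist : Disagreement - ½ ≤ NMDist N E p q f g
    disagreement-½-≤-NMDist = begin
      Disagreement - ½
        ≡⟨ cong₂ _-_ (sym Joint-disagree) ½≡ ⟩
      (b + c) - ½ * ((a + c) + (b + d))
        ≡⟨ solve 4 (λ a b c d → (b :+ c) :- con ½ :* ((a :+ c) :+ (b :+ d))
              := con ½ :* ((:- (a :- con ½ :* (a :+ c)) :+ (b :- con ½ :* (b :+ d)))
                        :+ ((c :- con ½ :* (a :+ c)) :+ :- (d :- con ½ :* (b :+ d))))) refl a b c d ⟩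
      ½ * ((- (a - ½ * (a + c)) + (b - ½ * (b + d))) + ((c - ½ * (a + c)) + - (d - ½ * (b + d))))
        ≡⟨ cong (½ *_) (sym (cong₂ _+_ (cong₂ _+_ (cong -_ (X≡ true true)) (X≡ true false))
                                      (cong₂ _+_ (X≡ false true) (cong -_ (X≡ false false))))) ⟩
      ½ * ((- X true true + X true false) + (X false true + - X false false))
        ≤⟨ *-monoˡ-≤-0≤ {½} ≤-compute
             (+-mono-≤ (+-mono-≤ (-p≤∣p∣ (X true true)) (p≤∣p∣ (X true false)))
                       (+-mono-≤ (p≤∣p∣ (X false true)) (-p≤∣p∣ (X false false)))) ⟩
      NMDist N E p q f g ∎
      where
      open ≤-Reasoning
      a b c d : ℚ
      a = Joint true true
      b = Joint true false
      c = Joint false true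
      d = Joint false false

    ½-disagreement-≤-NMDist : ½ - Disagreement ≤ NMDist N E p q f g
    ½-disagreement-≤-NMDist = begin
      ½ - Disagreement
        ≡⟨ cong₂ _-_ ½≡ (sym Joint-disagree) ⟩
      ½ * ((a + c) + (b + d)) - (b + c)
        ≡⟨ solve 4 (λ a b c d → con ½ :* ((a :+ c) :+ (b :+ d)) :- (b :+ c)
              := con ½ :* (((a :- con ½ :* (a :+ c)) :+ :- (b :- con ½ :* (b :+ d)))
                        :+ (:- (c :- con ½ :* (a :+ c)) :+ (d :- con ½ :* (b :+ d))))) refl a b c d ⟩
      ½ * (((a - ½ * (a + c)) + - (b - ½ * (b + d))) + (- (c - ½ * (a + c)) + (d - ½ * (b + d))))
        ≡⟨ cong (½ *_) (sym (cong₂ _+_ (cong₂ _+_ (X≡ true true) (cong -_ (X≡ true false)))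
                                      (cong₂ _+_ (cong -_ (X≡ false true)) (X≡ false false)))) ⟩
      ½ * ((X true true + - X true false) + (- X false true + X false false))
        ≤⟨ *-monoˡ-≤-0≤ {½} ≤-compute
             (+-mono-≤ (+-mono-≤ (p≤∣p∣ (X true true)) (-p≤∣p∣ (X true false)))
                       (+-mono-≤ (-p≤∣p∣ (X false true)) (p≤∣p∣ (X false false)))) ⟩
      NMDist N E p q f g ∎
      where
      open ≤-Reasoning
      a b c d : ℚ
      a = Joint true true
      b = Joint true false
      c = Joint false true
      d = Joint false false

-- Uniform sources on large sets

module Reciprocal (s : ℚ) (0<s : 0ℚ < s) where
  private instance
    s-positive : Positive s
    s-positive = positive 0<s
    s-nonZero : NonZero s
    s-nonZero = pos⇒nonZero s

  inverse : ℚ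
  inverse = 1/ s

  0≤inverse : 0ℚ ≤ inverse
  0≤inverse = <⇒≤ (positive⁻¹ (1/ s) {{1/pos⇒pos s}})

  s*inverse≡1 : s * inverse ≡ 1ℚ
  s*inverse≡1 = *-inverseʳ s

uniform-isSource : ∀ {N K} (R : Fin N → Bool) (c : ℚ) → 0ℚ ≤ K → 0ℚ ≤ c →
                   count N R * c ≡ 1ℚ → K ≤ count N R → IsSource N K (λ x → 𝟙 (R x) * c)
uniform-isSource {N} {K} R c 0≤K 0≤c total K≤R =
  ((λ x → *-nonNeg (𝟙-nonNeg (R x)) 0≤c) , trans (count-*ʳ N R c) total) ,
  λ x → begin
    𝟙 (R x) * c * K    ≡⟨ *-assoc (𝟙 (R x)) c K ⟩
    𝟙 (R x) * (c * K)  ≤⟨ *-mono-≤-0≤ (𝟙-nonNeg (R x)) (*-nonNeg 0≤c 0≤K) (𝟙-≤1 (R x)) cK≤1 ⟩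
    1ℚ * 1ℚ            ≡⟨⟩
    1ℚ                 ∎
  where
  open ≤-Reasoning
  cK≤1 : c * K ≤ 1ℚ
  cK≤1 = ≤-trans (*-monoˡ-≤-0≤ 0≤c K≤R) (≤-reflexive (trans (*-comm c _) total))

disagreements : (N : ℕ) → (Fin N → Fin N → Bool) → (P Q : Fin N → Bool) → (f g : Fin N → Fin N) → ℚ
disagreements N E P Q f g = Σℚ N (λ x → Σℚ N (λ y → (𝟙 (P x) * 𝟙 (Q y)) * 𝟙 (E x y xor E (f x) (g y))))

module UniformSources {N : ℕ} {K ε : ℚ} {E : Fin N → Fin N → Bool} (nm : IsNMExtractorPerm N K ε E)
  (0<K : 0ℚ < K) (f g : Fin N ↔ Fin N)
  (f-moves : NoFixedPoints (Inverse.to f)) (g-moves : NoFixedPoints (Inverse.to g))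
  (P Q : Fin N → Bool) (K≤P : K ≤ count N P) (K≤Q : K ≤ count N Q) where

  private
    sP sQ : ℚ
    sP = count N P
    sQ = count N Q
    open Reciprocal sP (<-≤-trans 0<K K≤P) renaming (inverse to a; 0≤inverse to 0≤a; s*inverse≡1 to sPa≡1)
    open Reciprocal sQ (<-≤-trans 0<K K≤Q) renaming (inverse to b; 0≤inverse to 0≤b; s*inverse≡1 to sQb≡1)
    p q : Fin N → ℚ
    p x = 𝟙 (P x) * a
    q y = 𝟙 (Q y) * b
    D : ℚ
    D = disagreements N E P Q (Inverse.to f) (Inverse.to g)
    0≤sPsQ : 0ℚ ≤ sP * sQ
    0≤sPsQ = *-nonNeg (count-nonNeg N P) (count-nonNeg N Q)

    open NonMalleability N E p q (Inverse.to f) (Inverse.to g)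

    NMDist≤ε : NMDist N E p q (Inverse.to f) (Inverse.to g) ≤ ε
    NMDist≤ε = nm p q (uniform-isSource P a (<⇒≤ 0<K) 0≤a sPa≡1 K≤P)
                      (uniform-isSource Q b (<⇒≤ 0<K) 0≤b sQb≡1 K≤Q) f g f-moves g-moves

    Σp≡1 : Σℚ N p ≡ 1ℚ
    Σp≡1 = trans (count-*ʳ N P a) sPa≡1
    Σq≡1 : Σℚ N q ≡ 1ℚ
    Σq≡1 = trans (count-*ʳ N Q b) sQb≡1

    Disagreement≡ : Disagreement ≡ (a * b) * D
    Disagreement≡ = trans (Σ²-cong N (λ x y → solve 5
        (λ u a v b t → (u :* a) :* (v :* b) :* t := (a :* b) :* ((u :* v) :* t)) refl
        (𝟙 (P x)) a (𝟙 (Q y)) b (𝟙 (E x y xor E (Inverse.to f x) (Inverse.to g y)))))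
      (Σ²-*ˡ N (a * b) _)

    rescale : (sP * sQ) * ((a * b) * D) ≡ D
    rescale = begin
      (sP * sQ) * ((a * b) * D)  ≡⟨ solve 5 (λ s t a b d → (s :* t) :* ((a :* b) :* d) := (s :* a) :* ((t :* b) :* d)) refl sP sQ a b D ⟩
      (sP * a) * ((sQ * b) * D)  ≡⟨ cong₂ (λ u v → u * (v * D)) sPa≡1 sQb≡1 ⟩
      1ℚ * (1ℚ * D)              ≡⟨ trans (*-identityˡ _) (*-identityˡ D) ⟩
      D                          ∎
      where open ≡-Reasoning

  disagreements-≥ : (½ - ε) * (count N P * count N Q) ≤ disagreements N E P Q (Inverse.to f) (Inverse.to g)
  disagreements-≥ = begin
    (½ - ε) * (sP * sQ)        ≡⟨ *-comm (½ - ε) _ ⟩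
    (sP * sQ) * (½ - ε)        ≤⟨ *-monoˡ-≤-0≤ 0≤sPsQ (p-q≤r⇒p-r≤q {½} (≤-trans (½-disagreement-≤-NMDist Σp≡1 Σq≡1) NMDist≤ε)) ⟩
    (sP * sQ) * Disagreement   ≡⟨ cong ((sP * sQ) *_) Disagreement≡ ⟩
    (sP * sQ) * ((a * b) * D)  ≡⟨ rescale ⟩
    D                          ∎
    where open ≤-Reasoning

  disagreements-≤ : disagreements N E P Q (Inverse.to f) (Inverse.to g) ≤ (½ + ε) * (count N P * count N Q)
  disagreements-≤ = begin
    D                          ≡⟨ rescale ⟨
    (sP * sQ) * ((a * b) * D)  ≡⟨ cong ((sP * sQ) *_) Disagreement≡ ⟨
    (sP * sQ) * Disagreement   ≤⟨ *-monoˡ-≤-0≤ 0≤sPsQ (p-q≤r⇒p≤q+r {q = ½} (≤-trans (disagreement-½-≤-NMDist Σp≡1 Σq≡1) NMDist≤ε)) ⟩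
    (sP * sQ) * (½ + ε)        ≡⟨ *-comm _ (½ + ε) ⟩
    (½ + ε) * (sP * sQ)        ∎
    where open ≤-Reasoning

-- Disagreements between G and its permuted copy

T-ext : ∀ {a b} → (T a → T b) → (T b → T a) → a ≡ b
T-ext {true}  {true}  _   _   = refl
T-ext {true}  {false} a⇒b _   = ⊥-elim (a⇒b tt)
T-ext {false} {true}  _   b⇒a = ⊥-elim (b⇒a tt)
T-ext {false} {false} _   _   = refl

==V⇒≡ : ∀ {N} {u v : V N} → T (u ==V v) → u ≡ v
==V⇒≡ {u = true  , i} {true  , j} h = cong (true ,_) (==F⇒≡ h)
==V⇒≡ {u = false , i} {false , j} h = cong (false ,_) (==F⇒≡ h)

≡⇒==V : ∀ {N} {u v : V N} → u ≡ v → T (u ==V v)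
≡⇒==V {u = true  , i} refl = ≡⇒==F {x = i} refl
≡⇒==V {u = false , i} refl = ≡⇒==F {x = i} refl

¬==F⇒≢ : ∀ {n} {x y : Fin n} → T (not (x ==F y)) → x ≢ y
¬==F⇒≢ {x = x} {y} h x≡y = subst T (Equivalence.to T-not-≡ h) (≡⇒==F x≡y)

𝟙-not-∧ : ∀ b c → 𝟙 (not (b ∧ c)) ≡ 𝟙 (not b) + 𝟙 (b ∧ not c)
𝟙-not-∧ true  true  = refl
𝟙-not-∧ true  false = refl
𝟙-not-∧ false c     = refl

𝟙[a⊕b]-𝟙[¬z]≤𝟙u : ∀ u a b z → (T z → (a xor b) ≡ u) → 𝟙 (a xor b) - 𝟙 (not z) ≤ 𝟙 u
𝟙[a⊕b]-𝟙[¬z]≤𝟙u u a b true  same rewrite same tt =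
  ≤-reflexive (solve 1 (λ x → x :- con 0ℚ := x) refl (𝟙 u))
𝟙[a⊕b]-𝟙[¬z]≤𝟙u u a b false _ =
  ≤-trans (≤-trans (+-monoˡ-≤ (- 1ℚ) (𝟙-≤1 (a xor b))) ≤-compute) (𝟙-nonNeg u)

module Disagreements (N : ℕ) (E : Fin N → Fin N → Bool) (π : V N ↔ V N) where

  σ : V N → V N
  σ = Inverse.from π

  A : V N → V N → Bool
  A = Gadj N E

  n : ℚ
  n = toℚ N

  disagreementsAt : V N → ℚ
  disagreementsAt a = ΣV N (λ b → 𝟙 (A a b xor A (σ a) (σ b)))

  allDisagreements : ℚ
  allDisagreements = ΣV N disagreementsAt

  disagreementsAt-nonNeg : ∀ a → 0ℚ ≤ disagreementsAt a
  disagreementsAt-nonNeg a = ΣV-nonNeg N (λ b → 𝟙-nonNeg (A a b xor A (σ a) (σ b)))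

  side : Bool → Fin N → Bool
  side τ j = proj₁ (σ (τ , j))

  image : Bool → Fin N → Fin N
  image τ j = proj₂ (σ (τ , j))

  crossing shifted : Bool → Fin N → Bool
  crossing τ j = not (side τ j ==B τ)
  shifted  τ j = (side τ j ==B τ) ∧ not (image τ j ==F j)

  movedOn : Bool → ℚ
  movedOn τ = count N (λ j → not (σ (τ , j) ==V (τ , j)))

  Moved≡ : Moved N π ≡ movedOn true + movedOn false
  Moved≡ = cong₂ _+_ (Σ-cong N (λ i → cong (𝟙 ∘ not) (moved⇔ (true , i))))
                     (Σ-cong N (λ j → cong (𝟙 ∘ not) (moved⇔ (false , j))))
    where
    moved⇔ : ∀ v → (Inverse.to π v ==V v) ≡ (σ v ==V v)
    moved⇔ v = T-ext
      (λ h → ≡⇒==V (trans (cong σ (sym (==V⇒≡ h))) (Inverse.strictlyInverseʳ π v)))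
      (λ h → ≡⇒==V (trans (cong (Inverse.to π) (sym (==V⇒≡ h))) (Inverse.strictlyInverseˡ π v)))

  movedOn-split : ∀ τ → movedOn τ ≡ count N (crossing τ) + count N (shifted τ)
  movedOn-split τ = trans (Σ-cong N (λ j → 𝟙-not-∧ (side τ j ==B τ) (image τ j ==F j))) (Σ-+ N _ _)

  movedOn-≤n : ∀ τ → movedOn τ ≤ n
  movedOn-≤n τ = count-≤n N _

  σ-shifted : ∀ τ j → T (shifted τ j) → σ (τ , j) ≡ (τ , image τ j)
  σ-shifted τ j h = cong (_, image τ j) (==B⇒≡ (proj₁ (Equivalence.to T-∧ h)))
    where
    ==B⇒≡ : ∀ {a b} → T (a ==B b) → a ≡ b
    ==B⇒≡ {true}  {true}  _ = refl
    ==B⇒≡ {false} {false} _ = refl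

  σ-crossing : ∀ τ j → T (crossing τ j) → σ (τ , j) ≡ (not τ , image τ j)
  σ-crossing τ j h = cong (_, image τ j) (¬==B⇒≡not (side τ j) τ h)
    where
    ¬==B⇒≡not : ∀ a b → T (not (a ==B b)) → a ≡ not b
    ¬==B⇒≡not true  false _ = refl
    ¬==B⇒≡not false true  _ = refl

  shifted-moves : ∀ τ j → T (shifted τ j) → image τ j ≢ j
  shifted-moves τ j h = ¬==F⇒≢ (proj₂ (Equivalence.to T-∧ h))

  shifted-injective : ∀ τ i j → T (shifted τ i) → T (shifted τ j) → image τ i ≡ image τ j → i ≡ j
  shifted-injective τ i j hi hj same-image = cong proj₂ (begin
    (τ , i)                         ≡⟨ Inverse.strictlyInverseˡ π (τ , i) ⟨
    Inverse.to π (σ (τ , i))        ≡⟨ cong (Inverse.to π) (σ-shifted τ i hi) ⟩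
    Inverse.to π (τ , image τ i)    ≡⟨ cong (λ k → Inverse.to π (τ , k)) same-image ⟩
    Inverse.to π (τ , image τ j)    ≡⟨ cong (Inverse.to π) (σ-shifted τ j hj) ⟨
    Inverse.to π (σ (τ , j))        ≡⟨ Inverse.strictlyInverseˡ π (τ , j) ⟩
    (τ , j)                         ∎)
    where open ≡-Reasoning

  degree : V N → ℚ
  degree v = ΣV N (λ b → 𝟙 (A v b))

  degree-σ : ∀ a → ΣV N (λ b → 𝟙 (A (σ a) (σ b))) ≡ degree (σ a)
  degree-σ a = ΣV-permute (↔-sym π) (λ b → 𝟙 (A (σ a) b))

  degree-σ-≤ : ∀ a → degree a - degree (σ a) ≤ disagreementsAt a
  degree-σ-≤ a = ≤-trans
    (≤-reflexive (trans (cong (_-_ (degree a)) (sym (degree-σ a)))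
                        (sym (ΣV-sub N (λ b → 𝟙 (A a b)) (λ b → 𝟙 (A (σ a) (σ b)))))))
    (ΣV-mono-≤ N (λ b → 𝟙a-𝟙b≤𝟙[a⊕b] (A a b) (A (σ a) (σ b))))

  degree-σ-≥ : ∀ a → degree (σ a) - degree a ≤ disagreementsAt a
  degree-σ-≥ a = ≤-trans
    (≤-reflexive (trans (cong (λ d → d - degree a) (sym (degree-σ a)))
                        (sym (ΣV-sub N (λ b → 𝟙 (A (σ a) (σ b))) (λ b → 𝟙 (A a b))))))
    (ΣV-mono-≤ N (λ b → 𝟙b-𝟙a≤𝟙[a⊕b] (A a b) (A (σ a) (σ b))))

  -- only moved vertices of side τ can hide a difference between the rows of a and σ a
  row-≤ : ∀ a τ → Σℚ N (λ j → 𝟙 (A a (τ , j) xor A (σ a) (τ , j))) - movedOn τ ≤ disagreementsAt a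
  row-≤ a τ = begin
    Σℚ N (λ j → 𝟙 (A a (τ , j) xor A (σ a) (τ , j))) - movedOn τ
      ≡⟨ Σ-sub N _ _ ⟨
    Σℚ N (λ j → 𝟙 (A a (τ , j) xor A (σ a) (τ , j)) - 𝟙 (not (σ (τ , j) ==V (τ , j))))
      ≤⟨ Σ-mono-≤ N (λ j → 𝟙[a⊕b]-𝟙[¬z]≤𝟙u _ (A a (τ , j)) (A (σ a) (τ , j)) (σ (τ , j) ==V (τ , j))
                             (λ fixed → cong (λ w → A a (τ , j) xor A (σ a) w) (sym (==V⇒≡ fixed)))) ⟩
    Σℚ N (λ j → 𝟙 (A a (τ , j) xor A (σ a) (σ (τ , j))))
      ≤⟨ ΣV-side-≤ N (λ b → 𝟙-nonNeg (A a b xor A (σ a) (σ b))) τ ⟩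
    disagreementsAt a ∎
    where open ≤-Reasoning

  module _ {ε : ℚ} (qo : IsQuasiOrthogonal N ε E) where

    degree-V₁ : ∀ i → n - 1ℚ ≤ degree (true , i)
    degree-V₁ i = begin
      n - 1ℚ                                              ≡⟨ cong₂ _-_ (Σ-one N) (count-point N i) ⟨
      Σℚ N (λ _ → 1ℚ) - count N (_==F i)                  ≡⟨ Σ-sub N _ _ ⟨
      Σℚ N (λ k → 1ℚ - 𝟙 (k ==F i))                       ≡⟨ Σ-cong N (λ k → trans (cong (λ b → 1ℚ - 𝟙 b) (==F-sym k i)) (sym (𝟙-not (i ==F k)))) ⟩
      Σℚ N (λ k → 𝟙 (not (i ==F k)))                      ≤⟨ ΣV-side-≤ N (λ b → 𝟙-nonNeg (A (true , i) b)) true ⟩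
      degree (true , i)                                   ∎
      where
      open ≤-Reasoning
      ==F-sym : ∀ k i → (k ==F i) ≡ (i ==F k)
      ==F-sym k i = T-ext (λ h → ≡⇒==F {x = i} (sym (==F⇒≡ {x = k} h)))
                          (λ h → ≡⇒==F {x = k} (sym (==F⇒≡ {x = i} h)))

    degree-V₀ : ∀ k → degree (false , k) ≤ (½ + ε) * n
    degree-V₀ k = ≤-trans (≤-reflexive degree≡) (proj₁ (proj₂ qo) k true)
      where
      degree≡ : degree (false , k) ≡ count N (λ x → E x k ==B true)
      degree≡ = trans (trans (cong (_+_ (Σℚ N (λ i → 𝟙 (E i k)))) (Σ-zero N)) (+-identityʳ _))
                      (Σ-cong N (λ i → cong 𝟙 (sym (==B-true (E i k)))))
        where
        ==B-true : ∀ b → (b ==B true) ≡ b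
        ==B-true true  = refl
        ==B-true false = refl

    crossing-≤ : ∀ τ j → T (crossing τ j) → (n - 1ℚ) - (½ + ε) * n ≤ disagreementsAt (τ , j)
    crossing-≤ true  j h = ≤-trans
      (+-mono-≤ (degree-V₁ j) (neg-antimono-≤ (degree-V₀ (image true j))))
      (≤-trans (≤-reflexive (cong (λ w → degree (true , j) - degree w) (sym (σ-crossing true j h))))
               (degree-σ-≤ (true , j)))
    crossing-≤ false j h = ≤-trans
      (+-mono-≤ (degree-V₁ (image false j)) (neg-antimono-≤ (degree-V₀ j)))
      (≤-trans (≤-reflexive (cong (λ w → degree w - degree (false , j)) (sym (σ-crossing false j h))))
               (degree-σ-≥ (false , j)))

    shifted-≤ : ∀ τ j → T (shifted τ j) → (½ - ε) * n - movedOn (not τ) ≤ disagreementsAt (τ , j)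
    shifted-≤ τ j h = ≤-trans (+-monoˡ-≤ (- movedOn (not τ)) (≤-trans (rows-differ τ (shifted-moves τ j h)) (≤-reflexive (row≡ τ))))
      (subst (λ w → Σℚ N (λ k → 𝟙 (A (τ , j) (not τ , k) xor A w (not τ , k))) - movedOn (not τ) ≤ disagreementsAt (τ , j))
             (σ-shifted τ j h) (row-≤ (τ , j) (not τ)))
      where
      𝟙-xor : ∀ a b → 𝟙 (not (a ==B b)) ≡ 𝟙 (a xor b)
      𝟙-xor true  true  = refl
      𝟙-xor true  false = refl
      𝟙-xor false true  = refl
      𝟙-xor false false = refl
      rows-differ : ∀ τ → image τ j ≢ j →
                    (½ - ε) * n ≤ count N (λ k → not (A (τ , j) (not τ , k) ==B A (τ , image τ j) (not τ , k)))
      rows-differ true  moved = proj₁ (proj₂ (proj₂ qo)) j (image true j) (moved ∘ sym)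
      rows-differ false moved = proj₂ (proj₂ (proj₂ qo)) j (image false j) (moved ∘ sym)
      row≡ : ∀ τ → count N (λ k → not (A (τ , j) (not τ , k) ==B A (τ , image τ j) (not τ , k)))
                 ≡ Σℚ N (λ k → 𝟙 (A (τ , j) (not τ , k) xor A (τ , image τ j) (not τ , k)))
      row≡ τ = Σ-cong N (λ k → 𝟙-xor (A (τ , j) (not τ , k)) (A (τ , image τ j) (not τ , k)))

  disagreements-≤-all : (P Q : Fin N → Bool) (f g : Fin N → Fin N) →
    (∀ i → T (P i) → σ (true , i) ≡ (true , f i)) → (∀ j → T (Q j) → σ (false , j) ≡ (false , g j)) →
    disagreements N E P Q f g ≤ allDisagreements
  disagreements-≤-all P Q f g σ-P σ-Q = begin
    disagreements N E P Q f g
      ≤⟨ Σ-mono-≤ N (λ i → Σ-mono-≤ N (λ j → restrict (P i) (Q j) (λ Pi Qj →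
           cong₂ (λ u w → E i j xor A u w) (σ-P i Pi) (σ-Q j Qj)))) ⟩
    Σℚ N (λ i → Σℚ N (λ j → 𝟙 (A (true , i) (false , j) xor A (σ (true , i)) (σ (false , j)))))
      ≤⟨ Σ-mono-≤ N (λ i → ΣV-side-≤ N (λ b → 𝟙-nonNeg (A (true , i) b xor A (σ (true , i)) (σ b))) false) ⟩
    Σℚ N (λ i → disagreementsAt (true , i))
      ≤⟨ ΣV-side-≤ N disagreementsAt-nonNeg true ⟩
    allDisagreements ∎
    where
    open ≤-Reasoning
    restrict : ∀ a b {u w} → (T a → T b → u ≡ w) → (𝟙 a * 𝟙 b) * 𝟙 w ≤ 𝟙 u
    restrict true  true  {u} same = ≤-reflexive (trans (*-identityˡ _) (cong 𝟙 (sym (same tt tt))))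
    restrict true  false {u} {w} _ = ≤-trans (≤-reflexive (*-zeroˡ (𝟙 w))) (𝟙-nonNeg u)
    restrict false b     {u} {w} _ =
      ≤-trans (≤-reflexive (trans (cong (_* 𝟙 w) (*-zeroˡ (𝟙 b))) (*-zeroˡ (𝟙 w)))) (𝟙-nonNeg u)

  side-≤ : ∀ τ (xc xs : ℚ) →
    (∀ j → T (crossing τ j) → xc ≤ disagreementsAt (τ , j)) →
    (∀ j → T (shifted τ j) → xs ≤ disagreementsAt (τ , j)) →
    count N (crossing τ) * xc + count N (shifted τ) * xs ≤ Σℚ N (λ j → disagreementsAt (τ , j))
  side-≤ τ xc xs xc≤ xs≤ = begin
    count N (crossing τ) * xc + count N (shifted τ) * xs
      ≡⟨ cong₂ _+_ (count-*ʳ N (crossing τ) xc) (count-*ʳ N (shifted τ) xs) ⟨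
    Σℚ N (λ j → 𝟙 (crossing τ j) * xc) + Σℚ N (λ j → 𝟙 (shifted τ j) * xs)
      ≡⟨ Σ-+ N _ _ ⟨
    Σℚ N (λ j → 𝟙 (crossing τ j) * xc + 𝟙 (shifted τ j) * xs)
      ≤⟨ Σ-mono-≤ N (λ j → exclusive (crossing τ j) (shifted τ j) (disjoint (side τ j ==B τ) _)
                             (xc≤ j) (xs≤ j) (disagreementsAt-nonNeg (τ , j))) ⟩
    Σℚ N (λ j → disagreementsAt (τ , j)) ∎
    where
    open ≤-Reasoning
    disjoint : ∀ b c → ¬ (T (not b) × T (b ∧ c))
    disjoint true  c (() , _)
    disjoint false c (_ , ())
    exclusive : ∀ c s {x y d : ℚ} → ¬ (T c × T s) → (T c → x ≤ d) → (T s → y ≤ d) → 0ℚ ≤ d →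
                𝟙 c * x + 𝟙 s * y ≤ d
    exclusive true  true  excl _   _   _   = ⊥-elim (excl (tt , tt))
    exclusive true  false {x} {y} _ x≤d _ _ =
      ≤-trans (≤-reflexive (solve 2 (λ x y → con 1ℚ :* x :+ con 0ℚ :* y := x) refl x y)) (x≤d tt)
    exclusive false true  {x} {y} _ _ y≤d _ =
      ≤-trans (≤-reflexive (solve 2 (λ x y → con 0ℚ :* x :+ con 1ℚ :* y := y) refl x y)) (y≤d tt)
    exclusive false false {x} {y} _ _ _ 0≤d =
      ≤-trans (≤-reflexive (solve 2 (λ x y → con 0ℚ :* x :+ con 0ℚ :* y := con 0ℚ) refl x y)) 0≤d

-- u = δ n is the margin of quasi-orthogonality, c₁, c₀ count the crossing and nF, nG the
-- shifted vertices of V₁, V₀, and S stands for twice |E △ π(E)|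
module RobustnessArithmetic (δ n c₁ nF c₀ nG S : ℚ)
  (0<δ : 0ℚ < δ) (δ≤½ : δ ≤ ½) (0≤n : 0ℚ ≤ n)
  (0≤c₁ : 0ℚ ≤ c₁) (0≤nF : 0ℚ ≤ nF) (0≤c₀ : 0ℚ ≤ c₀) (0≤nG : 0ℚ ≤ nG)
  (2≤u : + 2 / 1 ≤ δ * n) (m₁≤n : c₁ + nF ≤ n) (m₀≤n : c₀ + nG ≤ n)
  (weighted : ∀ xc xF xG → (xc ≤ δ * n - 1ℚ ⊎ xc ≤ 0ℚ) → (xF ≤ δ * n - (c₀ + nG) ⊎ xF ≤ 0ℚ) →
              (xG ≤ δ * n - (c₁ + nF) ⊎ xG ≤ 0ℚ) → (c₁ * xc + nF * xF) + (c₀ * xc + nG * xG) ≤ S)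
  (extractor : + 3 / 4 * (δ * n) ≤ nF → + 3 / 4 * (δ * n) ≤ nG → δ * ((δ * n) * (δ * n)) * (+ 1 / 16) ≤ S)
  where

  private
    u t m : ℚ
    u = δ * n
    t = + 1 / 8 * u
    m = (c₁ + nF) + (c₀ + nG)
    0≤δ : 0ℚ ≤ δ
    0≤δ = <⇒≤ 0<δ
    0≤u : 0ℚ ≤ u
    0≤u = *-nonNeg 0≤δ 0≤n
    0≤u-2 : 0ℚ ≤ u - + 2 / 1
    0≤u-2 = p≤q⇒0≤q-p 2≤u
    0≤½-δ : 0ℚ ≤ ½ - δ
    0≤½-δ = p≤q⇒0≤q-p δ≤½
    0≤m : 0ℚ ≤ m
    0≤m = +-nonNeg (+-nonNeg 0≤c₁ 0≤nF) (+-nonNeg 0≤c₀ 0≤nG)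

  -- since m ≤ 2 n
  from-quadratic : δ * (u * u) * (+ 1 / 16) ≤ S → (δ * δ * δ * (+ 1 / 32)) * n * m ≤ S
  from-quadratic = ≤-trans (≤-byDifference
    ((δ * δ * δ * (+ 1 / 32)) * n * ((n - (c₁ + nF)) + (n - (c₀ + nG))))
    (*-nonNeg (*-nonNeg (*-nonNeg (*-nonNeg (*-nonNeg 0≤δ 0≤δ) 0≤δ) (0≤-literal (+ 1 / 32))) 0≤n)
              (+-nonNeg (p≤q⇒0≤q-p m₁≤n) (p≤q⇒0≤q-p m₀≤n)))
    (solve 6 (λ d n a b c e → d :* ((d :* n) :* (d :* n)) :* con (+ 1 / 16)
                                :- (d :* d :* d :* con (+ 1 / 32)) :* n :* ((a :+ b) :+ (c :+ e))
                 := (d :* d :* d :* con (+ 1 / 32)) :* n :* ((n :- (a :+ b)) :+ (n :- (c :+ e))))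
       refl δ n c₁ nF c₀ nG))

  t≤u-1 : t ≤ u - 1ℚ
  t≤u-1 = ≤-byDifference (+ 7 / 8 * (u - + 2 / 1) + + 3 / 4) (+-nonNeg (*-nonNeg (0≤-literal (+ 7 / 8)) 0≤u-2) (0≤-literal (+ 3 / 4)))
    (solve 1 (λ u → (u :- con 1ℚ) :- con (+ 1 / 8) :* u
                    := con (+ 7 / 8) :* (u :- con (+ 2 / 1)) :+ con (+ 3 / 4)) refl u)

  many-crossing : t ≤ c₁ + c₀ →
    δ * (u * u) * (+ 1 / 16) ≤ (c₁ * (u - 1ℚ) + nF * 0ℚ) + (c₀ * (u - 1ℚ) + nG * 0ℚ)
  many-crossing t≤c = ≤-byDifference
    (((c₁ + c₀) - t) * ((u - + 2 / 1) + 1ℚ) + (+ 1 / 16 * u) * (u - + 2 / 1) + (+ 1 / 16 * u) * ((½ - δ + ½) * u))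
    (+-nonNeg (+-nonNeg (*-nonNeg (p≤q⇒0≤q-p t≤c) (+-nonNeg 0≤u-2 (0≤-literal 1ℚ))) (*-nonNeg (*-nonNeg (0≤-literal (+ 1 / 16)) 0≤u) 0≤u-2))
              (*-nonNeg (*-nonNeg (0≤-literal (+ 1 / 16)) 0≤u) (*-nonNeg (+-nonNeg 0≤½-δ (0≤-literal ½)) 0≤u)))
    (solve 6 (λ d n a b c e → ((a :* ((d :* n) :- con 1ℚ) :+ b :* con 0ℚ) :+ (c :* ((d :* n) :- con 1ℚ) :+ e :* con 0ℚ))
                                :- d :* ((d :* n) :* (d :* n)) :* con (+ 1 / 16)
          := ((a :+ c) :- con (+ 1 / 8) :* (d :* n)) :* (((d :* n) :- con (+ 2 / 1)) :+ con 1ℚ)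
             :+ (con (+ 1 / 16) :* (d :* n)) :* ((d :* n) :- con (+ 2 / 1))
             :+ (con (+ 1 / 16) :* (d :* n)) :* ((con ½ :- d :+ con ½) :* (d :* n)))
       refl δ n c₁ nF c₀ nG)

  room : ∀ {a b x} → 0ℚ ≤ a → a + b ≤ t → x ≤ + 3 / 4 * u → t ≤ u - (b + x)
  room {a} {b} {x} 0≤a a+b≤t x≤ = ≤-byDifference ((t - (a + b)) + a + (+ 3 / 4 * u - x))
    (+-nonNeg (+-nonNeg (p≤q⇒0≤q-p a+b≤t) 0≤a) (p≤q⇒0≤q-p x≤))
    (solve 4 (λ u a b x → (u :- (b :+ x)) :- con (+ 1 / 8) :* u
                 := ((con (+ 1 / 8) :* u :- (a :+ b)) :+ a) :+ (con (+ 3 / 4) :* u :- x)) refl u a b x)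

  all-small : (δ * δ * δ * (+ 1 / 32)) * n * m ≤ (c₁ * t + nF * t) + (c₀ * t + nG * t)
  all-small = ≤-byDifference (m * n * δ * (+ 1 / 32) * ((½ - δ + + 3 / 2) * (δ + + 2 / 1)))
    (*-nonNeg (*-nonNeg (*-nonNeg (*-nonNeg 0≤m 0≤n) 0≤δ) (0≤-literal (+ 1 / 32))) (*-nonNeg (+-nonNeg 0≤½-δ (0≤-literal (+ 3 / 2))) (+-nonNeg 0≤δ (0≤-literal (+ 2 / 1)))))
    (solve 6 (λ d n a b c e → ((a :* (con (+ 1 / 8) :* (d :* n)) :+ b :* (con (+ 1 / 8) :* (d :* n)))
                                :+ (c :* (con (+ 1 / 8) :* (d :* n)) :+ e :* (con (+ 1 / 8) :* (d :* n))))
                                :- (d :* d :* d :* con (+ 1 / 32)) :* n :* ((a :+ b) :+ (c :+ e))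
          := ((a :+ b) :+ (c :+ e)) :* n :* d :* con (+ 1 / 32) :* ((con ½ :- d :+ con (+ 3 / 2)) :* (d :+ con (+ 2 / 1))))
       refl δ n c₁ nF c₀ nG)

  one-large : ∀ {x} → + 3 / 4 * u ≤ x → δ * (u * u) * (+ 1 / 16) ≤ x * t
  one-large {x} 3u/4≤x = ≤-byDifference ((x - + 3 / 4 * u) * t + (+ 1 / 32 * (u * u)) * ((½ - δ) + (½ - δ) + + 2 / 1))
    (+-nonNeg (*-nonNeg (p≤q⇒0≤q-p 3u/4≤x) (*-nonNeg (0≤-literal (+ 1 / 8)) 0≤u))
              (*-nonNeg (*-nonNeg (0≤-literal (+ 1 / 32)) (*-nonNeg 0≤u 0≤u)) (+-nonNeg (+-nonNeg 0≤½-δ 0≤½-δ) (0≤-literal (+ 2 / 1)))))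
    (solve 3 (λ d u x → x :* (con (+ 1 / 8) :* u) :- d :* (u :* u) :* con (+ 1 / 16)
                 := (x :- con (+ 3 / 4) :* u) :* (con (+ 1 / 8) :* u)
                    :+ (con (+ 1 / 32) :* (u :* u)) :* ((con ½ :- d) :+ (con ½ :- d) :+ con (+ 2 / 1))) refl δ u x)

  robust : (δ * δ * δ * (+ 1 / 32)) * n * m ≤ S
  robust with ≤-total t (c₁ + c₀)
  ... | inj₁ t≤c = from-quadratic (≤-trans (many-crossing t≤c)
                     (weighted (u - 1ℚ) 0ℚ 0ℚ (inj₁ ≤-refl) (inj₂ ≤-refl) (inj₂ ≤-refl)))
  ... | inj₂ c≤t with ≤-total (+ 3 / 4 * u) nF | ≤-total (+ 3 / 4 * u) nG
  ...   | inj₁ F-large | inj₁ G-large = from-quadratic (extractor F-large G-large)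
  ...   | inj₂ F-small | inj₂ G-small = ≤-trans all-small
          (weighted t t t (inj₁ t≤u-1) (inj₁ (room 0≤c₁ c≤t G-small))
                          (inj₁ (room 0≤c₀ (≤-trans (≤-reflexive (+-comm c₀ c₁)) c≤t) F-small)))
  ...   | inj₁ F-large | inj₂ G-small = from-quadratic (≤-trans (one-large F-large) (≤-trans
          (≤-reflexive (solve 5 (λ t a b c e → b :* t := (a :* con 0ℚ :+ b :* t) :+ (c :* con 0ℚ :+ e :* con 0ℚ)) refl t c₁ nF c₀ nG))
          (weighted 0ℚ t 0ℚ (inj₂ ≤-refl) (inj₁ (room 0≤c₁ c≤t G-small)) (inj₂ ≤-refl))))
  ...   | inj₂ F-small | inj₁ G-large = from-quadratic (≤-trans (one-large G-large) (≤-trans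
          (≤-reflexive (solve 5 (λ t a b c e → e :* t := (a :* con 0ℚ :+ b :* con 0ℚ) :+ (c :* con 0ℚ :+ e :* t)) refl t c₁ nF c₀ nG))
          (weighted 0ℚ 0ℚ t (inj₂ ≤-refl) (inj₂ ≤-refl)
            (inj₁ (room 0≤c₀ (≤-trans (≤-reflexive (+-comm c₀ c₁)) c≤t) F-small)))))

-- Robust self-ordering of G

module _ {ε : ℚ} (0<ε : 0ℚ < ε) (ε<½ : ε < ½) where

  0<½-ε : 0ℚ < ½ - ε
  0<½-ε = ≤-<-trans (≤-reflexive (sym (+-inverseʳ ε))) (+-monoˡ-< (- ε) ε<½)

  ½-ε≤½ : ½ - ε ≤ ½
  ½-ε≤½ = ≤-byDifference ε (<⇒≤ 0<ε) (solve 2 (λ h e → h :- (h :- e) := e) refl ½ ε)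

  1≰½+ε : ¬ (1ℚ ≤ ½ + ε)
  1≰½+ε 1≤ = <-irrefl refl (≤-<-trans 1≤ (+-monoʳ-< ½ ε<½))

  robustness : ℚ
  robustness = (½ - ε) * (½ - ε) * (½ - ε) * (+ 1 / 128)

  0<robustness : 0ℚ < robustness
  0<robustness = *-pos (*-pos (*-pos 0<½-ε 0<½-ε) 0<½-ε) (positive⁻¹ (+ 1 / 128))

  -- a row of a single vertex agrees with itself
  not-quasiOrthogonal₁ : ∀ E → ¬ IsQuasiOrthogonal 1 ε E
  not-quasiOrthogonal₁ E qo = 1≰½+ε (≤-trans (≤-reflexive (sym count≡1))
    (≤-trans (proj₁ qo F.zero (E F.zero F.zero)) (≤-reflexive (*-identityʳ (½ + ε)))))
    where
    ==B-refl : ∀ b → (b ==B b) ≡ true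
    ==B-refl true  = refl
    ==B-refl false = refl
    count≡1 : count 1 (λ y → E F.zero y ==B E F.zero F.zero) ≡ 1ℚ
    count≡1 = cong (λ b → 𝟙 b + 0ℚ) (==B-refl (E F.zero F.zero))

  -- a one-point source disagrees either always or never
  not-nmExtractor-K≤1 : ∀ {N K E} (z₁ z₂ : Fin N) → z₁ ≢ z₂ → 0ℚ < K → K ≤ 1ℚ →
                        ¬ IsNMExtractorPerm N K ε E
  not-nmExtractor-K≤1 {N} {K} {E} z₁ z₂ z₁≢z₂ 0<K K≤1 nm =
    impossible (E z₁ z₁ xor E (d z₁) (d z₁))
      (subst₂ (λ s t → (½ - ε) * (s * s) ≤ t) count≡1 disagreements≡ U.disagreements-≥)
      (subst₂ (λ s t → t ≤ (½ + ε) * (s * s)) count≡1 disagreements≡ U.disagreements-≤)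
    where
    D : Fin N ↔ Fin N
    D = cycle (allFin N)
    d : Fin N → Fin N
    d = Inverse.to D
    D-derangement : NoFixedPoints d
    D-derangement = cycle-derangement (allFin N) (allFin⁺ N) ∈-allFin z₁ z₂ z₁≢z₂
    count≡1 : count N (_==F z₁) ≡ 1ℚ
    count≡1 = count-point N z₁
    K≤count : K ≤ count N (_==F z₁)
    K≤count = ≤-trans K≤1 (≤-reflexive (sym count≡1))
    module U = UniformSources {E = E} nm 0<K D D D-derangement D-derangement (_==F z₁) (_==F z₁) K≤count K≤count
    disagreements≡ : disagreements N E (_==F z₁) (_==F z₁) d d ≡ 𝟙 (E z₁ z₁ xor E (d z₁) (d z₁))
    disagreements≡ = trans
      (Σ-cong N (λ x → trans (Σ-cong N (λ y → *-assoc (𝟙 (x ==F z₁)) (𝟙 (y ==F z₁)) _))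
                       (trans (Σ-*ˡ N (𝟙 (x ==F z₁)) _)
                              (cong (𝟙 (x ==F z₁) *_) (Σ-point N z₁ (λ y → 𝟙 (E x y xor E (d x) (d y))))))))
      (Σ-point N z₁ (λ x → 𝟙 (E x z₁ xor E (d x) (d z₁))))
    impossible : ∀ b → (½ - ε) * (1ℚ * 1ℚ) ≤ 𝟙 b → 𝟙 b ≤ (½ + ε) * (1ℚ * 1ℚ) → ⊥
    impossible true  _ ≤½+ε = 1≰½+ε (≤-trans ≤½+ε (≤-reflexive (*-identityʳ (½ + ε))))
    impossible false ½-ε≤ _ = <-irrefl refl (<-≤-trans 0<½-ε (≤-trans (≤-reflexive (sym (*-identityʳ _))) ½-ε≤))

  module LargeCase {N : ℕ} {K : ℚ} {E : Fin N → Fin N → Bool}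
    (qo : IsQuasiOrthogonal N ε E) (nm : IsNMExtractorPerm N K ε E)
    (0<K : 0ℚ < K) (1≤K : 1ℚ ≤ K) (K≤ : K ≤ toℚ N * (+ 1 / 4) * (½ - ε))
    (z₁ z₂ : Fin N) (z₁≢z₂ : z₁ ≢ z₂) (π : V N ↔ V N) where

    open Disagreements N E π

    private
      δ u : ℚ
      δ = ½ - ε
      u = δ * n
      c₁ nF c₀ nG : ℚ
      c₁ = count N (crossing true)
      nF = count N (shifted true)
      c₀ = count N (crossing false)
      nG = count N (shifted false)

    2≤u : + 2 / 1 ≤ u
    2≤u = ≤-byDifference (+ 4 / 1 * ((n * (+ 1 / 4) * δ) - K) + + 4 / 1 * (K - 1ℚ) + + 2 / 1)
      (+-nonNeg (+-nonNeg (*-nonNeg (0≤-literal (+ 4 / 1)) (p≤q⇒0≤q-p K≤))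
                          (*-nonNeg (0≤-literal (+ 4 / 1)) (p≤q⇒0≤q-p 1≤K))) (0≤-literal (+ 2 / 1)))
      (solve 3 (λ d n k → d :* n :- con (+ 2 / 1)
                   := con (+ 4 / 1) :* ((n :* con (+ 1 / 4) :* d) :- k) :+ con (+ 4 / 1) :* (k :- con 1ℚ) :+ con (+ 2 / 1))
         refl δ n K)

    bound-or-zero : ∀ {x b d} → (x ≤ b ⊎ x ≤ 0ℚ) → b ≤ d → 0ℚ ≤ d → x ≤ d
    bound-or-zero (inj₁ x≤b) b≤d _   = ≤-trans x≤b b≤d
    bound-or-zero (inj₂ x≤0) _   0≤d = ≤-trans x≤0 0≤d

    weighted : ∀ xc xF xG → (xc ≤ u - 1ℚ ⊎ xc ≤ 0ℚ) → (xF ≤ u - (c₀ + nG) ⊎ xF ≤ 0ℚ) →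
               (xG ≤ u - (c₁ + nF) ⊎ xG ≤ 0ℚ) → (c₁ * xc + nF * xF) + (c₀ * xc + nG * xG) ≤ allDisagreements
    weighted xc xF xG hc hF hG =
      +-mono-≤ (side-≤ true  xc xF (crossing-bound true)  (shifted-bound true  hF))
               (side-≤ false xc xG (crossing-bound false) (shifted-bound false hG))
      where
      u-1≡ : u - 1ℚ ≡ (n - 1ℚ) - (½ + ε) * n
      u-1≡ = solve 2 (λ e n → (con ½ :- e) :* n :- con 1ℚ := (n :- con 1ℚ) :- (con ½ :+ e) :* n) refl ε n
      crossing-bound : ∀ τ j → T (crossing τ j) → xc ≤ disagreementsAt (τ , j)
      crossing-bound τ j h = bound-or-zero hc (≤-trans (≤-reflexive u-1≡) (crossing-≤ {ε} qo τ j h))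
                                              (disagreementsAt-nonNeg (τ , j))
      shifted-bound : ∀ τ {x} → (x ≤ u - (count N (crossing (not τ)) + count N (shifted (not τ))) ⊎ x ≤ 0ℚ) →
                      ∀ j → T (shifted τ j) → x ≤ disagreementsAt (τ , j)
      shifted-bound τ hx j h = bound-or-zero hx
        (≤-trans (≤-reflexive (cong (_-_ u) (sym (movedOn-split (not τ))))) (shifted-≤ {ε} qo τ j h))
        (disagreementsAt-nonNeg (τ , j))

    K≤¼u : K ≤ + 1 / 4 * u
    K≤¼u = ≤-trans K≤ (≤-reflexive (solve 2 (λ d n → n :* con (+ 1 / 4) :* d := con (+ 1 / 4) :* (d :* n)) refl δ n))

    quarter : ∀ {x s} → x ≤ toℚ 3 * s → + 3 / 4 * u ≤ x → + 1 / 4 * u ≤ s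
    quarter {x} {s} x≤3s 3u/4≤x = ≤-byDifference (+ 1 / 3 * (toℚ 3 * s - x) + + 1 / 3 * (x - + 3 / 4 * u))
      (+-nonNeg (*-nonNeg (0≤-literal (+ 1 / 3)) (p≤q⇒0≤q-p x≤3s)) (*-nonNeg (0≤-literal (+ 1 / 3)) (p≤q⇒0≤q-p 3u/4≤x)))
      (solve 3 (λ s x u → s :- con (+ 1 / 4) :* u
                   := con (+ 1 / 3) :* (con (toℚ 3) :* s :- x) :+ con (+ 1 / 3) :* (x :- con (+ 3 / 4) :* u)) refl s x u)

    extractor : + 3 / 4 * u ≤ nF → + 3 / 4 * u ≤ nG → δ * (u * u) * (+ 1 / 16) ≤ allDisagreements
    extractor F-large G-large = begin
      δ * (u * u) * (+ 1 / 16)                   ≡⟨ solve 2 (λ d u → d :* (u :* u) :* con (+ 1 / 16) := d :* ((con (+ 1 / 4) :* u) :* (con (+ 1 / 4) :* u))) refl δ u ⟩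
      δ * ((+ 1 / 4 * u) * (+ 1 / 4 * u))         ≤⟨ *-monoˡ-≤-0≤ (<⇒≤ 0<½-ε) (*-mono-≤-0≤ 0≤¼u 0≤¼u ¼u≤P ¼u≤Q) ⟩
      δ * (count N V₁.domain * count N V₀.domain)   ≤⟨ U.disagreements-≥ ⟩
      disagreements N E V₁.domain V₀.domain (Inverse.to V₁.perm) (Inverse.to V₀.perm)
        ≤⟨ disagreements-≤-all V₁.domain V₀.domain (Inverse.to V₁.perm) (Inverse.to V₀.perm)
             (σ-agrees true V₁.domain V₁.perm V₁.domain⊆S V₁.agrees) (σ-agrees false V₀.domain V₀.perm V₀.domain⊆S V₀.agrees) ⟩
      allDisagreements                            ∎
      where
      open ≤-Reasoning
      module V₁ = AgreeingDerangement (agreeingDerangement (shifted true) (image true)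
                   (shifted-moves true) (shifted-injective true) z₁ z₂ z₁≢z₂)
      module V₀ = AgreeingDerangement (agreeingDerangement (shifted false) (image false)
                   (shifted-moves false) (shifted-injective false) z₁ z₂ z₁≢z₂)
      0≤¼u : 0ℚ ≤ + 1 / 4 * u
      0≤¼u = *-nonNeg (0≤-literal (+ 1 / 4)) (≤-trans (0≤-literal (+ 2 / 1)) 2≤u)
      ¼u≤P : + 1 / 4 * u ≤ count N V₁.domain
      ¼u≤P = quarter V₁.large F-large
      ¼u≤Q : + 1 / 4 * u ≤ count N V₀.domain
      ¼u≤Q = quarter V₀.large G-large
      module U = UniformSources {E = E} nm 0<K V₁.perm V₀.perm V₁.derangement V₀.derangement
                   V₁.domain V₀.domain (≤-trans K≤¼u ¼u≤P) (≤-trans K≤¼u ¼u≤Q)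
      σ-agrees : ∀ τ (P : Fin N → Bool) (D : Fin N ↔ Fin N) → (∀ x → T (P x) → T (shifted τ x)) →
                 (∀ x → T (P x) → Inverse.to D x ≡ image τ x) →
                 ∀ i → T (P i) → σ (τ , i) ≡ (τ , Inverse.to D i)
      σ-agrees τ P D P⊆ agrees i Pi = trans (σ-shifted τ i (P⊆ i Pi)) (cong (τ ,_) (sym (agrees i Pi)))

    robust : robustness * (+ 2 / 1) * n * Moved N π ≤ SymDiffSize N (Gadj N E) π
    robust = begin
      robustness * (+ 2 / 1) * n * Moved N π
        ≡⟨ cong (robustness * (+ 2 / 1) * n *_) (trans Moved≡ (cong₂ _+_ (movedOn-split true) (movedOn-split false))) ⟩
      robustness * (+ 2 / 1) * n * ((c₁ + nF) + (c₀ + nG))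
        ≡⟨ solve 6 (λ d n a b c e → (d :* d :* d :* con (+ 1 / 128)) :* con (+ 2 / 1) :* n :* ((a :+ b) :+ (c :+ e))
                      := con ½ :* ((d :* d :* d :* con (+ 1 / 32)) :* n :* ((a :+ b) :+ (c :+ e)))) refl δ n c₁ nF c₀ nG ⟩
      ½ * ((δ * δ * δ * (+ 1 / 32)) * n * ((c₁ + nF) + (c₀ + nG)))
        ≤⟨ *-monoˡ-≤-0≤ (0≤-literal ½) (RobustnessArithmetic.robust δ n c₁ nF c₀ nG allDisagreements
             0<½-ε ½-ε≤½ (toℚ-nonNeg N) (count-nonNeg N _) (count-nonNeg N _) (count-nonNeg N _) (count-nonNeg N _)
             2≤u (m≤n true) (m≤n false) weighted extractor) ⟩
      ½ * allDisagreements ∎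
      where
      open ≤-Reasoning
      m≤n : ∀ τ → count N (crossing τ) + count N (shifted τ) ≤ n
      m≤n τ = ≤-trans (≤-reflexive (sym (movedOn-split τ))) (movedOn-≤n τ)

  robustlySelfOrdered : ∀ N K → 0ℚ < K → K ≤ toℚ N * (+ 1 / 4) * (½ - ε) →
    (E : Fin N → Fin N → Bool) → IsQuasiOrthogonal N ε E → IsNMExtractorPerm N K ε E →
    RobustlySelfOrdered N (Gadj N E) (robustness * (+ 2 / 1) * toℚ N)
  robustlySelfOrdered zero K 0<K K≤ E qo nm π = ≤-trans
    (≤-reflexive (solve 2 (λ c x → c :* con (+ 2 / 1) :* con 0ℚ :* x := con 0ℚ) refl robustness (Moved zero π)))
    (*-nonNeg (0≤-literal ½) (ΣV-nonNeg zero (λ a → Disagreements.disagreementsAt-nonNeg zero E π a)))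
  robustlySelfOrdered (suc zero) K 0<K K≤ E qo nm π = ⊥-elim (not-quasiOrthogonal₁ E qo)
  robustlySelfOrdered (suc (suc M)) K 0<K K≤ E qo nm π with ≤-total K 1ℚ
  ... | inj₁ K≤1 = ⊥-elim (not-nmExtractor-K≤1 {E = E} F.zero (F.suc F.zero) (λ ()) 0<K K≤1 nm)
  ... | inj₂ 1≤K = LargeCase.robust {E = E} qo nm 0<K 1≤K K≤ F.zero (F.suc F.zero) (λ ()) π

isNMExtractor⇒isNMExtractorPerm : ∀ {N K ε E} → IsNMExtractor N K ε E → IsNMExtractorPerm N K ε E
isNMExtractor⇒isNMExtractorPerm nm p q p-source q-source f g =
  nm p q p-source q-source (Inverse.to f) (Inverse.to g)

theorem8p3 : (ε : ℚ) → 0ℚ < ε → ε < ½ →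
    Σ ℚ (λ c → 0ℚ < c ×
      ((N : ℕ) → (K : ℚ) → 0ℚ < K → K ≤ toℚ N →
       K ≤ toℚ N * (+ 1 / 4) * (½ - ε) →
       (nmE : Fin N → Fin N → Bool) → IsQuasiOrthogonal N ε nmE →
       (IsNMExtractor N K ε nmE →
          RobustlySelfOrdered N (Gadj N nmE) (c * (+ 2 / 1) * toℚ N)) ×
       (IsNMExtractorPerm N K ε nmE →
          RobustlySelfOrdered N (Gadj N nmE) (c * (+ 2 / 1) * toℚ N))))
theorem8p3 ε 0<ε ε<½ = robustness 0<ε ε<½ , 0<robustness 0<ε ε<½ , λ N K 0<K _ K≤ E qo →
  (robustlySelfOrdered 0<ε ε<½ N K 0<K K≤ E qo ∘ isNMExtractor⇒isNMExtractorPerm {E = E}) ,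
  robustlySelfOrdered 0<ε ε<½ N K 0<K K≤ E qo
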